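{- Let $n\ge1$ and let $S$ be a subgraph of $K_{n+1}$ consisting of $n+1$ edges. Suppose $S$ contains exactly one cycle $\Gamma=(v_1,\dots,v_\ell,v_{\ell+1}=v_1)$, of length $\ell\le n+1$, given by its vertex sequence (with $v_1,\dots,v_\ell$ distinct). Then $$\operatorname{sign}(S)=\{\widetilde{\mathrm{asc}}(\sigma),\widetilde{\mathrm{dsc}}(\sigma)\},$$ where $\sigma=v_1v_2\cdots v_\ell$.
   Context: $K_{n+1}$ is the complete graph on $[n+1]=\{1,\dots,n+1\}$. Each edge $\{i,j\}$ with $i<j$ is identified with the positive root $\epsilon_i-\epsilon_j=\sum_{k=i}^{j-1}\alpha_k$ of type $A_n$, where $\alpha_k=\epsilon_k-\epsilon_{k+1}$, and each root with its coefficient vector in $\mathbb{Z}^n$ with respect to $\alpha_1,\dots,\alpha_n$. For $n$ roots, $\det$ is the determinant of the matrix of their coefficient vectors. For a tuple $(\beta_1,\dots,\beta_{n+1})$ of roots let $d_k=(-1)^k\det(\beta_1,\dots,\widehat{\beta_k},\dots,\beta_{n+1})$; its signature is the unordered pair $\{a,b\}$ with $a=\#\{k:d_k=1\}$, $b=\#\{k:d_k=-1\}$. For the edge set $S$ (of $n+1$ distinct roots), $\operatorname{sign}(S)$ is the signature of any ordering of $S$ (independent of the ordering). For a sequence $\sigma=v_1\cdots v_\ell$ of distinct integers, with $v_{\ell+1}:=v_1$, the number of cyclic ascents is $\widetilde{\mathrm{asc}}(\sigma)=\#\{i\in[\ell]: v_i<v_{i+1}\}$ and the number of cyclic descents is $\widetilde{\mathrm{dsc}}(\sigma)=\#\{i\in[\ell]: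 v_i>v_{i+1}\}$. -}

module Defs where

open import Data.Nat as ℕ using (ℕ; zero; suc)
open import Data.Integer as ℤ using (ℤ; +_; -_)
open import Data.Fin as F using (Fin; zero; suc; toℕ; punchIn; _<_; _<?_)
open import Data.Bool using (Bool; true; false; if_then_else_)
open import Data.Product using (_×_; _,_; proj₁; proj₂; ∃)
open import Data.Sum using (_⊎_)
open import Relation.Nullary using (does)
open import Relation.Binary.PropositionalEquality using (_≡_)
open import Function.Definitions using (Injective)
open import Function.Bundles using (_⇔_)

-- Vertices of K_{n+1} are Fin (suc n): index i represents vertex i+1.
-- Simple roots α_1..α_n are indexed by Fin n: index k represents α_{k+1}.

-- An edge of K_m, written as an ordered pair (i , j); edges of S satisfy i < j.
Edge : ℕ → Set
Edge m = Fin m × Fin m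

-- Coefficient vector of the root ε_i - ε_j = α_i + ... + α_{j-1} (for i < j):
-- coefficient of α_k is 1 iff i ≤ k < j.
coeff : ∀ {n} → Edge (suc n) → Fin n → ℤ
coeff (i , j) k =
  if does (toℕ k ℕ.<? toℕ i) then + 0
  else (if does (toℕ k ℕ.<? toℕ j) then + 1 else + 0)

sumFin : ∀ {m} → (Fin m → ℤ) → ℤ
sumFin {zero} f = + 0
sumFin {suc m} f = f zero ℤ.+ sumFin (λ i → f (suc i))

signℤ : ℕ → ℤ
signℤ zero = + 1
signℤ (suc k) = - signℤ k

det : ∀ {m} → (Fin m → Fin m → ℤ) → ℤ
det {zero} M = + 1
det {suc m} M =
  sumFin (λ j → signℤ (toℕ j) ℤ.* (M zero j ℤ.* det (λ r c → M (suc r) (punchIn j c))))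

-- d_k = (-1)^k det(β_1,...,β̂_k,...,β_{n+1}), k 1-based (k = toℕ k' + 1);
-- row r of the matrix is the coefficient vector of the r-th remaining root.
dCoef : ∀ {n} → (Fin (suc n) → Edge (suc n)) → Fin (suc n) → ℤ
dCoef β k = signℤ (suc (toℕ k)) ℤ.* det (λ r c → coeff (β (punchIn k r)) c)

countFin : ∀ {m} → (Fin m → Bool) → ℕ
countFin {zero} p = zero
countFin {suc m} p = (if p zero then 1 else 0) ℕ.+ countFin (λ i → p (suc i))

isℤ : ℤ → ℤ → Bool
isℤ x y = does (x ℤ.≟ y)

sigA sigB : ∀ {n} → (Fin (suc n) → Edge (suc n)) → ℕ
sigA β = countFin (λ k → isℤ (dCoef β k) (+ 1))
sigB β = countFin (λ k → isℤ (dCoef β k) (- + 1))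

PairEq : ℕ → ℕ → ℕ → ℕ → Set
PairEq a b c d = (a ≡ c × b ≡ d) ⊎ (a ≡ d × b ≡ c)

nextC : ∀ {m} → Fin (suc m) → Fin (suc m)
nextC {zero} zero = zero
nextC {suc m} zero = suc zero
nextC {suc m} (suc i) with nextC {m} i
... | zero = zero
... | suc j = suc (suc j)

Adj : ∀ {N K} → (Fin K → Edge N) → Fin N → Fin N → Set
Adj S u v = ∃ λ k → (S k ≡ (u , v)) ⊎ (S k ≡ (v , u))

IsCycle : ∀ {N K m} → (Fin K → Edge N) → (Fin (suc m) → Fin N) → Set
IsCycle {m = m} S v =
  (3 ℕ.≤ suc m) × Injective _≡_ _≡_ v × (∀ i → Adj S (v i) (v (nextC i)))

CycEdge : ∀ {N m} → (Fin (suc m) → Fin N) → Fin N → Fin N → Set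
CycEdge v a b = ∃ λ i → (v i ≡ a × v (nextC i) ≡ b) ⊎ (v i ≡ b × v (nextC i) ≡ a)

casc cdsc : ∀ {N m} → (Fin (suc m) → Fin N) → ℕ
casc v = countFin (λ i → does (v i <? v (nextC i)))
cdsc v = countFin (λ i → does (v (nextC i) <? v i))

-- Let B be the (n+1)×n matrix whose rows are the roots of S, so that d is the vector of signed
-- maximal minors of B.  Expanding B with a repeated column shows that d lies in the left kernel
-- of B.  So does the signed indicator z of the cycle Γ, giving the edge {v_i, v_{i+1}} the sign +1
-- at an ascent and -1 at a descent: row {i < j} of B is [i ≤ c] − [j ≤ c], and these telescope
-- around Γ.  Reading a left-kernel vector as a flow, no vertex has degree one in its support; since
-- Γ is the only cycle of S, removing an edge e of Γ leaves a forest, so a left-kernel vector that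
-- vanishes at e vanishes everywhere and d = μ z with μ = d_e z_e.  Finally ± d_e is the
-- determinant of the interval matrix of a forest, which is ±1 by expansion along the column of a
-- leaf.  Hence d takes the value μ exactly at the ascents of σ and -μ exactly at its descents.

module Submission where

open import Defs

open import Algebra.Bundles using (CommutativeMonoid)
import Algebra.Properties.CommutativeMonoid.Sum as MonoidSum
open import Data.Bool using (Bool; true; false; if_then_else_; _∧_; _∨_; not; T)
open import Data.Bool.Properties using (∧-zeroʳ; ∧-conicalˡ; ∧-conicalʳ; ∨-zeroʳ)
open import Data.Empty using (⊥-elim)
open import Data.Fin as F using (Fin; zero; suc; toℕ; punchIn; punchOut; inject₁; inject; fromℕ; fromℕ<; _<_)
import Data.Fin.Properties as FP
open import Data.Integer as ℤ using (ℤ; -_; _+_; _-_; _*_; 0ℤ; 1ℤ; -1ℤ)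
import Data.Integer.Properties as ℤP
open import Data.Integer.Tactic.RingSolver using (solve-∀)
open import Data.Nat as ℕ using (ℕ; zero; suc; _≤_; z≤n; s≤s)
import Data.Nat.Properties as ℕP
open import Data.Product using (∃; ∃₂; Σ; _×_; _,_; proj₁; proj₂)
open import Data.Sum using (_⊎_; inj₁; inj₂)
open import Data.Unit using (tt)
open import Data.Vec.Functional using (Vector; removeAt; insertAt; updateAt)
import Data.Vec.Functional.Properties as VFP
open import Function using (_∘_)
open import Function.Bundles using (_⇔_; mk⇔; Equivalence)
open import Function.Definitions using (Injective)
open import Relation.Binary.Definitions using (tri<; tri≈; tri>)
open import Relation.Binary.PropositionalEquality
  using (_≡_; _≢_; refl; sym; trans; cong; cong₂; subst; module ≡-Reasoning)
open import Relation.Nullary using (¬_; Dec; contradiction; does; yes; no; ¬?)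
open import Relation.Nullary.Decidable using (dec-true; dec-false; decidable-stable)
open import Relation.Nullary.Reflects using (ofʸ; ofⁿ)

module CommutativeMonoidSum {c ℓ} (M : CommutativeMonoid c ℓ) where
  open CommutativeMonoid M
    using (_≈_; _∙_; ε; ∙-cong; ∙-congˡ; identityˡ; identityʳ; setoid)
    renaming (Carrier to A; refl to ≈-refl)
  open MonoidSum M public
  open import Relation.Binary.Reasoning.Setoid setoid

  sum-zero : ∀ {m} (f : Vector A m) → (∀ i → f i ≈ ε) → sum f ≈ ε
  sum-zero {zero}  f f≈ε = ≈-refl
  sum-zero {suc m} f f≈ε = begin
    f zero ∙ sum (f ∘ suc)  ≈⟨ ∙-cong (f≈ε zero) (sum-zero (f ∘ suc) (f≈ε ∘ suc)) ⟩
    ε ∙ ε                   ≈⟨ identityˡ ε ⟩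
    ε                       ∎

  sum-single : ∀ {m} (p : Fin m) (f : Vector A m) → (∀ i → i ≢ p → f i ≈ ε) → sum f ≈ f p
  sum-single {suc m} p f off = begin
    sum f                     ≈⟨ sum-remove f ⟩
    f p ∙ sum (removeAt f p)  ≈⟨ ∙-congˡ (sum-zero (removeAt f p) (λ i → off (punchIn p i) (FP.punchInᵢ≢i p i))) ⟩
    f p ∙ ε                   ≈⟨ identityʳ (f p) ⟩
    f p                       ∎

  sum-injective-reindex : ∀ {k l} (κ : Fin l → Fin k) (f : Vector A k) → Injective _≡_ _≡_ κ →
                          (∀ j → (∀ i → κ i ≢ j) → f j ≈ ε) → sum f ≈ sum (f ∘ κ)
  sum-injective-reindex {l = zero} κ f _ off = sum-zero f (λ j → off j λ ())
  sum-injective-reindex {zero} {suc l} κ f _ off with () ← κ zero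
  sum-injective-reindex {suc k} {suc l} κ f κ-inj off = begin
    sum f
      ≈⟨ sum-remove f ⟩
    f (κ zero) ∙ sum (removeAt f (κ zero))
      ≈⟨ ∙-congˡ (sum-injective-reindex κ′ (removeAt f (κ zero)) κ′-inj off′) ⟩
    f (κ zero) ∙ sum (removeAt f (κ zero) ∘ κ′)
      ≡⟨ cong (f (κ zero) ∙_) (sum-cong-≗ (cong f ∘ κ′-eq)) ⟩
    sum (f ∘ κ) ∎
    where
    κ₀≢κₛ : ∀ i → κ zero ≢ κ (suc i)
    κ₀≢κₛ i eq with () ← κ-inj eq
    κ′ : Fin l → Fin k
    κ′ i = punchOut (κ₀≢κₛ i)
    κ′-eq : ∀ i → punchIn (κ zero) (κ′ i) ≡ κ (suc i)
    κ′-eq i = FP.punchIn-punchOut (κ₀≢κₛ i)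
    κ′-inj : Injective _≡_ _≡_ κ′
    κ′-inj {i} {j} eq =
      FP.suc-injective (κ-inj (trans (sym (κ′-eq i)) (trans (cong (punchIn (κ zero)) eq) (κ′-eq j))))
    off′ : ∀ j → (∀ i → κ′ i ≢ j) → removeAt f (κ zero) j ≈ ε
    off′ j j∉κ′ = off _ missed
      where
      missed : ∀ i → κ i ≢ punchIn (κ zero) j
      missed zero    eq = FP.punchInᵢ≢i (κ zero) j (sym eq)
      missed (suc i) eq = j∉κ′ i (FP.punchIn-injective (κ zero) _ _ (trans (κ′-eq i) eq))

open import Algebra.Properties.Semiring.Sum ℤP.+-*-semiring
  using (sum; sum-cong-≗; sum-remove; ∑-distrib-+; ∑-comm; *-distribˡ-sum)
open CommutativeMonoidSum ℤP.+-0-commutativeMonoid using (sum-zero; sum-single; sum-injective-reindex)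
module ℕΣ = CommutativeMonoidSum ℕP.+-0-commutativeMonoid

sumFin≡sum : ∀ {m} (f : Fin m → ℤ) → sumFin f ≡ sum f
sumFin≡sum {zero}  f = refl
sumFin≡sum {suc m} f = cong (_+_ (f zero)) (sumFin≡sum (f ∘ suc))

neg-sum : ∀ {m} (f : Fin m → ℤ) → - sum f ≡ sum (λ i → - f i)
neg-sum f = begin
  - sum f                ≡⟨ ℤP.-1*i≡-i (sum f) ⟨
  -1ℤ * sum f            ≡⟨ *-distribˡ-sum -1ℤ f ⟩
  sum (λ i → -1ℤ * f i)  ≡⟨ sum-cong-≗ (ℤP.-1*i≡-i ∘ f) ⟩
  sum (λ i → - f i)      ∎
  where open ≡-Reasoning

∑-distrib-minus : ∀ {m} (f g : Fin m → ℤ) → sum (λ i → f i - g i) ≡ sum f - sum g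
∑-distrib-minus f g = trans (∑-distrib-+ f (λ i → - g i)) (cong (_+_ (sum f)) (sym (neg-sum g)))

indicator : Bool → ℕ
indicator b = if b then 1 else 0

countFin≡sum : ∀ {m} (p : Fin m → Bool) → countFin p ≡ ℕΣ.sum (indicator ∘ p)
countFin≡sum {zero}  p = refl
countFin≡sum {suc m} p = cong (indicator (p zero) ℕ.+_) (countFin≡sum (p ∘ suc))

count-cong : ∀ {m} {p q : Fin m → Bool} → (∀ i → p i ≡ q i) → countFin p ≡ countFin q
count-cong {p = p} {q} p≗q = begin
  countFin p                 ≡⟨ countFin≡sum p ⟩
  ℕΣ.sum (indicator ∘ p)     ≡⟨ ℕΣ.sum-cong-≗ (cong indicator ∘ p≗q) ⟩
  ℕΣ.sum (indicator ∘ q)     ≡⟨ countFin≡sum q ⟨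
  countFin q                 ∎
  where open ≡-Reasoning

count-remove : ∀ {m} (e : Fin (suc m)) (p : Fin (suc m) → Bool) →
               countFin p ≡ indicator (p e) ℕ.+ countFin (p ∘ punchIn e)
count-remove e p = begin
  countFin p
    ≡⟨ countFin≡sum p ⟩
  ℕΣ.sum (indicator ∘ p)
    ≡⟨ ℕΣ.sum-remove (indicator ∘ p) ⟩
  indicator (p e) ℕ.+ ℕΣ.sum (indicator ∘ p ∘ punchIn e)
    ≡⟨ cong (indicator (p e) ℕ.+_) (countFin≡sum (p ∘ punchIn e)) ⟨
  indicator (p e) ℕ.+ countFin (p ∘ punchIn e) ∎
  where open ≡-Reasoning

count-zero : ∀ {m} (p : Fin m → Bool) → (∀ i → p i ≡ false) → countFin p ≡ 0
count-zero p none = trans (countFin≡sum p) (ℕΣ.sum-zero (indicator ∘ p) (cong indicator ∘ none))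

count-injective-reindex : ∀ {k l} (κ : Fin l → Fin k) (p : Fin k → Bool) → Injective _≡_ _≡_ κ →
                          (∀ j → p j ≡ true → ∃ λ i → κ i ≡ j) → countFin p ≡ countFin (p ∘ κ)
count-injective-reindex κ p κ-inj onImage = begin
  countFin p                   ≡⟨ countFin≡sum p ⟩
  ℕΣ.sum (indicator ∘ p)       ≡⟨ ℕΣ.sum-injective-reindex κ (indicator ∘ p) κ-inj offImage ⟩
  ℕΣ.sum (indicator ∘ p ∘ κ)   ≡⟨ countFin≡sum (p ∘ κ) ⟨
  countFin (p ∘ κ)             ∎
  where
  open ≡-Reasoning
  offImage : ∀ j → (∀ i → κ i ≢ j) → indicator (p j) ≡ 0
  offImage j j∉κ with p j in pj
  ... | false = refl
  ... | true  = let (i , κi≡j) = onImage j pj in contradiction κi≡j (j∉κ i)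

count≢0⇒∃ : ∀ {m} (p : Fin m → Bool) → countFin p ≢ 0 → ∃ λ k → p k ≡ true
count≢0⇒∃ {zero}  p c≢0 = contradiction refl c≢0
count≢0⇒∃ {suc m} p c≢0 with p zero in p₀
... | true  = zero , p₀
... | false = let (k , pk) = count≢0⇒∃ (p ∘ suc) c≢0 in suc k , pk

count-remove-true : ∀ {m} (e : Fin (suc m)) (p : Fin (suc m) → Bool) → p e ≡ true →
                    countFin p ≡ suc (countFin (p ∘ punchIn e))
count-remove-true e p pe = trans (count-remove e p) (cong (λ b → indicator b ℕ.+ countFin (p ∘ punchIn e)) pe)

count≡0⇒false : ∀ {m} (p : Fin m → Bool) → countFin p ≡ 0 → ∀ k → p k ≡ false
count≡0⇒false {suc m} p c≡0 k with p k in pk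
... | false = refl
... | true with () ← trans (sym c≡0) (count-remove-true k p pk)

count≡1⇒unique : ∀ {m} (p : Fin m → Bool) → countFin p ≡ 1 →
                 ∃ λ r → p r ≡ true × (∀ k → k ≢ r → p k ≡ false)
count≡1⇒unique {zero}  p ()
count≡1⇒unique {suc m} p c≡1 with count≢0⇒∃ p (λ c≡0 → contradiction (trans (sym c≡0) c≡1) λ ())
... | r , pr = r , pr , others
  where
  rest≡0 : countFin (p ∘ punchIn r) ≡ 0
  rest≡0 = ℕP.suc-injective (trans (sym (count-remove-true r p pr)) c≡1)
  others : ∀ k → k ≢ r → p k ≡ false
  others k k≢r = subst (λ j → p j ≡ false) (FP.punchIn-punchOut (k≢r ∘ sym))
                   (count≡0⇒false (p ∘ punchIn r) rest≡0 (punchOut (k≢r ∘ sym)))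

count≢1⇒another : ∀ {m} (p : Fin m → Bool) (e : Fin m) → countFin p ≢ 1 → p e ≡ true →
                  ∃ λ e′ → e′ ≢ e × p e′ ≡ true
count≢1⇒another {suc m} p e c≢1 pe with count≢0⇒∃ (p ∘ punchIn e) (c≢1 ∘ trans (count-remove-true e p pe) ∘ cong suc)
... | k , pk = punchIn e k , FP.punchInᵢ≢i e k , pk

IsUnit : ℤ → Set
IsUnit x = x ≡ 1ℤ ⊎ x ≡ -1ℤ

IsUnit-* : ∀ {x y} → IsUnit x → IsUnit y → IsUnit (x * y)
IsUnit-* (inj₁ refl) (inj₁ refl) = inj₁ refl
IsUnit-* (inj₁ refl) (inj₂ refl) = inj₂ refl
IsUnit-* (inj₂ refl) (inj₁ refl) = inj₂ refl
IsUnit-* (inj₂ refl) (inj₂ refl) = inj₁ refl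

IsUnit-neg : ∀ {x} → IsUnit x → IsUnit (- x)
IsUnit-neg (inj₁ refl) = inj₂ refl
IsUnit-neg (inj₂ refl) = inj₁ refl

IsUnit≢0 : ∀ {x} → IsUnit x → x ≢ 0ℤ
IsUnit≢0 (inj₁ refl) ()
IsUnit≢0 (inj₂ refl) ()

IsUnit-sq : ∀ {x} → IsUnit x → x * x ≡ 1ℤ
IsUnit-sq (inj₁ refl) = refl
IsUnit-sq (inj₂ refl) = refl

IsUnit-signℤ : ∀ k → IsUnit (signℤ k)
IsUnit-signℤ zero    = inj₁ refl
IsUnit-signℤ (suc k) = IsUnit-neg (IsUnit-signℤ k)

IsUnit-cancelʳ-zero : ∀ {s} → IsUnit s → ∀ y → y * s ≡ 0ℤ → y ≡ 0ℤ
IsUnit-cancelʳ-zero s-unit y ys≡0 with ℤP.i*j≡0⇒i≡0∨j≡0 y ys≡0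
... | inj₁ y≡0 = y≡0
... | inj₂ s≡0 = contradiction s≡0 (IsUnit≢0 s-unit)

-- Determinants

Mat : ℕ → Set
Mat m = Fin m → Fin m → ℤ

sgn : ∀ {m} → Fin m → ℤ
sgn j = signℤ (toℕ j)

minor : ∀ {m} → Fin (suc m) → Fin (suc m) → Mat (suc m) → Mat m
minor r c M i j = M (punchIn r i) (punchIn c j)

det-expand : ∀ {m} (M : Mat (suc m)) → det M ≡ sum (λ j → sgn j * (M zero j * det (minor zero j M)))
det-expand M = sumFin≡sum (λ j → sgn j * (M zero j * det (minor zero j M)))

det-cong : ∀ {m} {M N : Mat m} → (∀ i j → M i j ≡ N i j) → det M ≡ det N
det-cong {zero}  M≗N = refl
det-cong {suc m} {M} {N} M≗N = begin
  det M                                                   ≡⟨ det-expand M ⟩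
  sum (λ j → sgn j * (M zero j * det (minor zero j M)))   ≡⟨ sum-cong-≗ term ⟩
  sum (λ j → sgn j * (N zero j * det (minor zero j N)))   ≡⟨ det-expand N ⟨
  det N                                                   ∎
  where
  open ≡-Reasoning
  term : ∀ j → sgn j * (M zero j * det (minor zero j M)) ≡ sgn j * (N zero j * det (minor zero j N))
  term j = cong₂ (λ x y → sgn j * (x * y)) (M≗N zero j) (det-cong (λ r c → M≗N (suc r) (punchIn j c)))

skipIndex : ∀ {m} → Fin (suc (suc m)) → Fin (suc m) → Fin (suc m)
skipIndex zero    j       = zero
skipIndex (suc c) zero    = c
skipIndex {suc m} (suc c) (suc j) = suc (skipIndex c j)

punchIn-skipIndex : ∀ {m} (c : Fin (suc (suc m))) (j : Fin (suc m)) →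
                    punchIn (punchIn c j) (skipIndex c j) ≡ c
punchIn-skipIndex zero    j       = refl
punchIn-skipIndex (suc c) zero    = refl
punchIn-skipIndex {suc m} (suc c) (suc j) = cong suc (punchIn-skipIndex c j)

punchIn-skipIndex-comm : ∀ {m} (c : Fin (suc (suc m))) (j : Fin (suc m)) (x : Fin m) →
                         punchIn (punchIn c j) (punchIn (skipIndex c j) x) ≡ punchIn c (punchIn j x)
punchIn-skipIndex-comm zero    j       x       = refl
punchIn-skipIndex-comm (suc c) zero    x       = refl
punchIn-skipIndex-comm {suc m} (suc c) (suc j) zero    = refl
punchIn-skipIndex-comm {suc m} (suc c) (suc j) (suc x) = cong suc (punchIn-skipIndex-comm c j x)

sgn-skipIndex : ∀ {m} (c : Fin (suc (suc m))) (j : Fin (suc m)) →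
                sgn (punchIn c j) * sgn (skipIndex c j) ≡ - (sgn c * sgn j)
sgn-skipIndex zero    j    = identity (sgn j)
  where
  identity : ∀ a → (- a) * 1ℤ ≡ - (1ℤ * a)
  identity = solve-∀
sgn-skipIndex (suc c) zero = identity (sgn c)
  where
  identity : ∀ a → 1ℤ * a ≡ - ((- a) * 1ℤ)
  identity = solve-∀
sgn-skipIndex {suc m} (suc c) (suc j) = begin
  (- sgn (punchIn c j)) * (- sgn (skipIndex c j))  ≡⟨ neg-square (sgn (punchIn c j)) (sgn (skipIndex c j)) ⟩
  sgn (punchIn c j) * sgn (skipIndex c j)          ≡⟨ sgn-skipIndex c j ⟩
  - (sgn c * sgn j)                                ≡⟨ cong -_ (neg-square (sgn c) (sgn j)) ⟨
  - ((- sgn c) * (- sgn j))                        ∎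
  where
  open ≡-Reasoning
  neg-square : ∀ a b → (- a) * (- b) ≡ a * b
  neg-square = solve-∀

*-*-distribˡ-sum : ∀ {m} a b (f : Fin m → ℤ) → a * (b * sum f) ≡ sum (λ i → a * (b * f i))
*-*-distribˡ-sum a b f = trans (cong (a *_) (*-distribˡ-sum b f)) (*-distribˡ-sum a (λ i → b * f i))

det-expand-col : ∀ {m} (M : Mat (suc m)) (c : Fin (suc m)) →
                 det M ≡ sum (λ r → (sgn r * sgn c) * (M r c * det (minor r c M)))
det-expand-col {zero} M zero = identity (M zero zero)
  where
  identity : ∀ x → 1ℤ * (x * 1ℤ) + 0ℤ ≡ (1ℤ * 1ℤ) * (x * 1ℤ) + 0ℤ
  identity = solve-∀
det-expand-col {suc m} M c = begin
  det M
    ≡⟨ det-expand M ⟩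
  sum rowTerm
    ≡⟨ sum-remove {i = c} rowTerm ⟩
  rowTerm c + sum (rowTerm ∘ punchIn c)
    ≡⟨ cong₂ _+_ (cong (_* (M zero c * det (minor zero c M))) (sym (ℤP.*-identityˡ (sgn c)))) rest ⟩
  colTerm zero + sum (colTerm ∘ suc) ∎
  where
  open ≡-Reasoning
  rowTerm : Fin (suc (suc m)) → ℤ
  rowTerm j = sgn j * (M zero j * det (minor zero j M))
  colTerm : Fin (suc (suc m)) → ℤ
  colTerm r = (sgn r * sgn c) * (M r c * det (minor r c M))
  -- Both sides expand into the minors D r j of M without rows 0, r+1 and columns c, punchIn c j.
  D : Fin (suc m) → Fin (suc m) → ℤ
  D r j = det (minor zero j (minor (suc r) c M))
  term : Fin (suc m) → Fin (suc m) → ℤ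
  term r j = (sgn (suc r) * sgn c) * (M (suc r) c * (sgn j * (M zero (punchIn c j) * D r j)))
  rowTerm-expand : ∀ j → rowTerm (punchIn c j) ≡ sum (λ r → term r j)
  rowTerm-expand j = begin
    s₀ * (m₀ * det M′)
      ≡⟨ cong (λ x → s₀ * (m₀ * x)) (det-expand-col M′ c′) ⟩
    s₀ * (m₀ * sum (λ r → (sgn r * sgn c′) * (M′ r c′ * det (minor r c′ M′))))
      ≡⟨ cong (λ x → s₀ * (m₀ * x)) (sum-cong-≗ entry) ⟩
    s₀ * (m₀ * sum (λ r → (sgn r * sgn c′) * (M (suc r) c * D r j)))
      ≡⟨ *-*-distribˡ-sum s₀ m₀ (λ r → (sgn r * sgn c′) * (M (suc r) c * D r j)) ⟩
    sum (λ r → s₀ * (m₀ * ((sgn r * sgn c′) * (M (suc r) c * D r j))))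
      ≡⟨ sum-cong-≗ (λ r → reorder s₀ (sgn c′) (sgn r) (sgn c) (sgn j) m₀ (M (suc r) c) (D r j) (sgn-skipIndex c j)) ⟩
    sum (λ r → term r j) ∎
    where
    M′ : Mat (suc m)
    M′ = minor zero (punchIn c j) M
    c′ : Fin (suc m)
    c′ = skipIndex c j
    s₀ m₀ : ℤ
    s₀ = sgn (punchIn c j)
    m₀ = M zero (punchIn c j)
    entry : ∀ r → (sgn r * sgn c′) * (M′ r c′ * det (minor r c′ M′)) ≡ (sgn r * sgn c′) * (M (suc r) c * D r j)
    entry r = cong₂ (λ x y → (sgn r * sgn c′) * (M (suc r) x * y)) (punchIn-skipIndex c j)
                (det-cong (λ x y → cong (M (suc (punchIn r x))) (punchIn-skipIndex-comm c j y)))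
    reorder : ∀ a t s u v b e d → a * t ≡ - (u * v) →
              a * (b * ((s * t) * (e * d))) ≡ (- s * u) * (e * (v * (b * d)))
    reorder a t s u v b e d at≡-uv = begin
      a * (b * ((s * t) * (e * d)))     ≡⟨ pull a t s b e d ⟩
      (a * t) * (s * (b * (e * d)))     ≡⟨ cong (λ x → x * (s * (b * (e * d)))) at≡-uv ⟩
      - (u * v) * (s * (b * (e * d)))   ≡⟨ push u v s b e d ⟩
      (- s * u) * (e * (v * (b * d)))   ∎
      where
      pull : ∀ a t s b e d → a * (b * ((s * t) * (e * d))) ≡ (a * t) * (s * (b * (e * d)))
      pull = solve-∀
      push : ∀ u v s b e d → - (u * v) * (s * (b * (e * d))) ≡ (- s * u) * (e * (v * (b * d)))
      push = solve-∀
  colTerm-expand : ∀ r → colTerm (suc r) ≡ sum (λ j → term r j)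
  colTerm-expand r =
    trans (cong (λ x → (sgn (suc r) * sgn c) * (M (suc r) c * x)) (det-expand (minor (suc r) c M)))
          (*-*-distribˡ-sum (sgn (suc r) * sgn c) (M (suc r) c) (λ j → sgn j * (M zero (punchIn c j) * D r j)))
  rest : sum (rowTerm ∘ punchIn c) ≡ sum (colTerm ∘ suc)
  rest = begin
    sum (rowTerm ∘ punchIn c)             ≡⟨ sum-cong-≗ rowTerm-expand ⟩
    sum (λ j → sum (λ r → term r j))      ≡⟨ ∑-comm (λ j r → term r j) ⟩
    sum (λ r → sum (λ j → term r j))      ≡⟨ sum-cong-≗ colTerm-expand ⟨
    sum (colTerm ∘ suc)                   ∎

det-linear-col : ∀ {m} (c : Fin (suc m)) (M A B : Mat (suc m)) (t : ℤ) →
                 (∀ r → M r c ≡ A r c + t * B r c) →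
                 (∀ r j → j ≢ c → M r j ≡ A r j) → (∀ r j → j ≢ c → M r j ≡ B r j) →
                 det M ≡ det A + t * det B
det-linear-col c M A B t col-c M≡A M≡B = begin
  det M
    ≡⟨ det-expand-col M c ⟩
  sum (λ r → (s r) * (M r c * det (minor r c M)))
    ≡⟨ sum-cong-≗ split ⟩
  sum (λ r → termA r + t * termB r)
    ≡⟨ ∑-distrib-+ termA (λ r → t * termB r) ⟩
  sum termA + sum (λ r → t * termB r)
    ≡⟨ cong₂ _+_ (det-expand-col A c) (trans (cong (t *_) (det-expand-col B c)) (*-distribˡ-sum t termB)) ⟨
  det A + t * det B ∎
  where
  open ≡-Reasoning
  s : Fin _ → ℤ
  s r = sgn r * sgn c
  termA termB : Fin _ → ℤ
  termA r = s r * (A r c * det (minor r c A))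
  termB r = s r * (B r c * det (minor r c B))
  distrib : ∀ s a b t d → s * ((a + t * b) * d) ≡ s * (a * d) + t * (s * (b * d))
  distrib = solve-∀
  minor-M≡A : ∀ r → det (minor r c M) ≡ det (minor r c A)
  minor-M≡A r = det-cong (λ x y → M≡A _ _ (FP.punchInᵢ≢i c y))
  minor-M≡B : ∀ r → det (minor r c M) ≡ det (minor r c B)
  minor-M≡B r = det-cong (λ x y → M≡B _ _ (FP.punchInᵢ≢i c y))
  split : ∀ r → s r * (M r c * det (minor r c M)) ≡ termA r + t * termB r
  split r = begin
    s r * (M r c * det (minor r c M))
      ≡⟨ cong (λ x → s r * (x * _)) (col-c r) ⟩
    s r * ((A r c + t * B r c) * det (minor r c M))
      ≡⟨ distrib (s r) (A r c) (B r c) t _ ⟩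
    s r * (A r c * det (minor r c M)) + t * (s r * (B r c * det (minor r c M)))
      ≡⟨ cong₂ (λ x y → s r * (A r c * x) + t * (s r * (B r c * y))) (minor-M≡A r) (minor-M≡B r) ⟩
    termA r + t * termB r ∎

punchIn-inject₁-self : ∀ {m} (a : Fin (suc m)) → punchIn (inject₁ a) a ≡ suc a
punchIn-inject₁-self zero            = refl
punchIn-inject₁-self {suc m} (suc a) = cong suc (punchIn-inject₁-self a)

sum-pair : ∀ {m} (a : Fin (suc m)) (f : Fin (suc (suc m)) → ℤ) →
           (∀ j → j ≢ inject₁ a → j ≢ suc a → f j ≡ 0ℤ) → sum f ≡ f (inject₁ a) + f (suc a)
sum-pair a f off = begin
  sum f
    ≡⟨ sum-remove {i = inject₁ a} f ⟩
  f (inject₁ a) + sum (f ∘ punchIn (inject₁ a))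
    ≡⟨ cong (_+_ (f (inject₁ a))) (sum-single a (f ∘ punchIn (inject₁ a)) off′) ⟩
  f (inject₁ a) + f (punchIn (inject₁ a) a)
    ≡⟨ cong (λ j → f (inject₁ a) + f j) (punchIn-inject₁-self a) ⟩
  f (inject₁ a) + f (suc a) ∎
  where
  open ≡-Reasoning
  off′ : ∀ i → i ≢ a → f (punchIn (inject₁ a) i) ≡ 0ℤ
  off′ i i≢a = off _ (FP.punchInᵢ≢i (inject₁ a) i)
    (λ eq → i≢a (FP.punchIn-injective (inject₁ a) _ _ (trans eq (sym (punchIn-inject₁-self a)))))

punchIn-adjacent : ∀ {m} (j : Fin (suc (suc m))) (a : Fin (suc m)) → j ≢ inject₁ a → j ≢ suc a →
                   Σ (Fin m) λ a′ → punchIn j (inject₁ a′) ≡ inject₁ a × punchIn j (suc a′) ≡ suc a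
punchIn-adjacent zero zero j≢a _ = contradiction refl j≢a
punchIn-adjacent {suc m} zero (suc a) _ _ = a , refl , refl
punchIn-adjacent (suc zero) zero _ j≢a+1 = contradiction refl j≢a+1
punchIn-adjacent {suc m} (suc (suc j)) zero _ _ = zero , refl , refl
punchIn-adjacent {suc m} (suc j) (suc a) j≢a j≢a+1 with punchIn-adjacent j a (j≢a ∘ cong suc) (j≢a+1 ∘ cong suc)
... | a′ , eq₁ , eq₂ = suc a′ , cong suc eq₁ , cong suc eq₂

punchIn-inject₁-suc : ∀ {m} (a y : Fin (suc m)) →
                      punchIn (inject₁ a) y ≡ punchIn (suc a) y ⊎
                      (punchIn (inject₁ a) y ≡ suc a × punchIn (suc a) y ≡ inject₁ a)
punchIn-inject₁-suc zero zero = inj₂ (refl , refl)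
punchIn-inject₁-suc zero (suc y) = inj₁ refl
punchIn-inject₁-suc {suc m} (suc a) zero = inj₁ refl
punchIn-inject₁-suc {suc m} (suc a) (suc y) with punchIn-inject₁-suc a y
... | inj₁ eq = inj₁ (cong suc eq)
... | inj₂ (eq₁ , eq₂) = inj₂ (cong suc eq₁ , cong suc eq₂)

det-adjacent-cols : ∀ {m} (M : Mat (suc m)) (a : Fin m) → (∀ r → M r (inject₁ a) ≡ M r (suc a)) → det M ≡ 0ℤ
det-adjacent-cols {suc m} M a cols≡ = begin
  det M
    ≡⟨ det-expand M ⟩
  sum rowTerm
    ≡⟨ sum-pair a rowTerm vanish ⟩
  rowTerm (inject₁ a) + rowTerm (suc a)
    ≡⟨ cong₂ (λ s x → s * x + rowTerm (suc a)) (cong signℤ (FP.toℕ-inject₁ a)) same ⟩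
  sgn a * x + (- sgn a) * x
    ≡⟨ cancel (sgn a) x ⟩
  0ℤ ∎
  where
  open ≡-Reasoning
  rowTerm : Fin (suc (suc m)) → ℤ
  rowTerm j = sgn j * (M zero j * det (minor zero j M))
  x : ℤ
  x = M zero (suc a) * det (minor zero (suc a) M)
  cancel : ∀ s x → s * x + (- s) * x ≡ 0ℤ
  cancel = solve-∀
  minors≡ : ∀ r y → minor zero (inject₁ a) M r y ≡ minor zero (suc a) M r y
  minors≡ r y with punchIn-inject₁-suc a y
  ... | inj₁ eq = cong (M (suc r)) eq
  ... | inj₂ (eq₁ , eq₂) = trans (cong (M (suc r)) eq₁) (trans (sym (cols≡ (suc r))) (cong (M (suc r)) (sym eq₂)))
  same : M zero (inject₁ a) * det (minor zero (inject₁ a) M) ≡ x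
  same = cong₂ _*_ (cols≡ zero) (det-cong minors≡)
  vanish : ∀ j → j ≢ inject₁ a → j ≢ suc a → rowTerm j ≡ 0ℤ
  vanish j j≢a j≢a+1 with punchIn-adjacent j a j≢a j≢a+1
  ... | a′ , eq₁ , eq₂ = begin
    sgn j * (M zero j * det (minor zero j M))
      ≡⟨ cong (λ d → sgn j * (M zero j * d)) (det-adjacent-cols (minor zero j M) a′ cols′) ⟩
    sgn j * (M zero j * 0ℤ)
      ≡⟨ cong (sgn j *_) (ℤP.*-zeroʳ (M zero j)) ⟩
    sgn j * 0ℤ
      ≡⟨ ℤP.*-zeroʳ (sgn j) ⟩
    0ℤ ∎
    where
    cols′ : ∀ r → minor zero j M r (inject₁ a′) ≡ minor zero j M r (suc a′)
    cols′ r = trans (cong (M (suc r)) eq₁) (trans (cols≡ (suc r)) (cong (M (suc r)) (sym eq₂)))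

det-subtract-adjacent-col : ∀ {m} (M : Mat (suc m)) (a : Fin m) →
                            det (λ i → updateAt (M i) (suc a) (_- M i (inject₁ a))) ≡ det M
det-subtract-adjacent-col M a = begin
  det M′
    ≡⟨ det-linear-col (suc a) M′ M M₂ -1ℤ at-col M′-off (λ i j j≢ → trans (M′-off i j j≢) (sym (M₂-off i j j≢)))
    ⟩
  det M + -1ℤ * det M₂
    ≡⟨ cong (λ d → det M + -1ℤ * d) (det-adjacent-cols M₂ a repeated) ⟩
  det M + -1ℤ * 0ℤ
    ≡⟨ ℤP.+-identityʳ (det M) ⟩
  det M ∎
  where
  open ≡-Reasoning
  M′ M₂ : Mat _
  M′ i = updateAt (M i) (suc a) (_- M i (inject₁ a))
  M₂ i = updateAt (M i) (suc a) (λ _ → M i (inject₁ a))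
  inject₁≢suc : inject₁ a ≢ suc a
  inject₁≢suc eq = ℕP.1+n≢n (sym (trans (sym (FP.toℕ-inject₁ a)) (cong toℕ eq)))
  at-col : ∀ i → M′ i (suc a) ≡ M i (suc a) + -1ℤ * M₂ i (suc a)
  at-col i = begin
    M′ i (suc a)                         ≡⟨ VFP.updateAt-updates (suc a) (M i) ⟩
    M i (suc a) - M i (inject₁ a)        ≡⟨ cong (_+_ (M i (suc a))) (ℤP.-1*i≡-i (M i (inject₁ a))) ⟨
    M i (suc a) + -1ℤ * M i (inject₁ a)  ≡⟨ cong (λ x → M i (suc a) + -1ℤ * x) (VFP.updateAt-updates (suc a) (M i)) ⟨
    M i (suc a) + -1ℤ * M₂ i (suc a)     ∎
  M′-off : ∀ i j → j ≢ suc a → M′ i j ≡ M i j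
  M′-off i j j≢ = VFP.updateAt-minimal j (suc a) (M i) j≢
  M₂-off : ∀ i j → j ≢ suc a → M₂ i j ≡ M i j
  M₂-off i j j≢ = VFP.updateAt-minimal j (suc a) (M i) j≢
  repeated : ∀ i → M₂ i (inject₁ a) ≡ M₂ i (suc a)
  repeated i = trans (M₂-off i (inject₁ a) inject₁≢suc) (sym (VFP.updateAt-updates (suc a) (M i)))

LeftKernel : ∀ {k m} → (Fin k → Fin m → ℤ) → (Fin k → ℤ) → Set
LeftKernel B y = ∀ c → sum (λ k → y k * B k c) ≡ 0ℤ

LeftKernel-cong : ∀ {k m} {B B′ : Fin k → Fin m → ℤ} {y} → (∀ i c → B i c ≡ B′ i c) →
                  LeftKernel B y → LeftKernel B′ y
LeftKernel-cong {y = y} B≡B′ kernel c = trans (sum-cong-≗ (λ i → cong (y i *_) (sym (B≡B′ i c)))) (kernel c)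

LeftKernel-combination : ∀ {k m} {B : Fin k → Fin m → ℤ} {y z} μ → LeftKernel B y → LeftKernel B z →
                         LeftKernel B (λ i → y i - μ * z i)
LeftKernel-combination {B = B} {y} {z} μ y-kernel z-kernel c = begin
  sum (λ i → (y i - μ * z i) * B i c)
    ≡⟨ sum-cong-≗ (λ i → distrib (y i) μ (z i) (B i c)) ⟩
  sum (λ i → y i * B i c - μ * (z i * B i c))
    ≡⟨ ∑-distrib-minus (λ i → y i * B i c) (λ i → μ * (z i * B i c)) ⟩
  sum (λ i → y i * B i c) - sum (λ i → μ * (z i * B i c))
    ≡⟨ cong (_-_ (sum (λ i → y i * B i c))) (*-distribˡ-sum μ (λ i → z i * B i c)) ⟨
  sum (λ i → y i * B i c) - μ * sum (λ i → z i * B i c)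
    ≡⟨ cong₂ (λ s t → s - μ * t) (y-kernel c) (z-kernel c) ⟩
  0ℤ - μ * 0ℤ
    ≡⟨ cong (_-_ 0ℤ) (ℤP.*-zeroʳ μ) ⟩
  0ℤ ∎
  where
  open ≡-Reasoning
  distrib : ∀ a u t b → (a - u * t) * b ≡ a * b - u * (t * b)
  distrib = solve-∀

signedMaximalMinors : ∀ {m} → (Fin (suc m) → Fin m → ℤ) → Fin (suc m) → ℤ
signedMaximalMinors B k = signℤ (suc (toℕ k)) * det (λ r → B (punchIn k r))

punchIn-suc-self : ∀ {m} (c : Fin m) → punchIn (suc c) c ≡ inject₁ c
punchIn-suc-self zero    = refl
punchIn-suc-self (suc c) = cong suc (punchIn-suc-self c)

-- Laplace expansion, along the copy, of B with its column c repeated next to itself.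
signedMaximalMinors-leftKernel : ∀ {m} (B : Fin (suc m) → Fin m → ℤ) → LeftKernel B (signedMaximalMinors B)
signedMaximalMinors-leftKernel B c = begin
  sum (λ k → (- sgn k * det (R k)) * B k c)
    ≡⟨ sum-cong-≗ (λ k → rearrange (sgn k) (sgn c) (B k c) (det (R k)) (IsUnit-sq (IsUnit-signℤ (toℕ c)))) ⟩
  sum (λ k → sgn c * ((sgn k * sgn (suc c)) * (B k c * det (R k))))
    ≡⟨ *-distribˡ-sum (sgn c) (λ k → (sgn k * sgn (suc c)) * (B k c * det (R k))) ⟨
  sgn c * sum (λ k → (sgn k * sgn (suc c)) * (B k c * det (R k)))
    ≡⟨ cong (sgn c *_) expand ⟨
  sgn c * det N
    ≡⟨ cong (sgn c *_) (det-adjacent-cols N c repeated) ⟩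
  sgn c * 0ℤ
    ≡⟨ ℤP.*-zeroʳ (sgn c) ⟩
  0ℤ ∎
  where
  open ≡-Reasoning
  R : Fin _ → Mat _
  R k r = B (punchIn k r)
  N : Mat _
  N r = insertAt (B r) (suc c) (B r c)
  repeated : ∀ r → N r (inject₁ c) ≡ N r (suc c)
  repeated r = trans (cong (N r) (sym (punchIn-suc-self c)))
                 (trans (VFP.insertAt-punchIn (B r) (suc c) (B r c) c) (sym (VFP.insertAt-lookup (B r) (suc c) (B r c))))
  expand : det N ≡ sum (λ k → (sgn k * sgn (suc c)) * (B k c * det (R k)))
  expand = trans (det-expand-col N (suc c)) (sum-cong-≗ (λ k → cong₂ (λ x y → (sgn k * sgn (suc c)) * (x * y))
             (VFP.insertAt-lookup (B k) (suc c) (B k c))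
             (det-cong (λ x y → VFP.insertAt-punchIn (B (punchIn k x)) (suc c) (B (punchIn k x) c) y))))
  rearrange : ∀ s t b d → t * t ≡ 1ℤ → (- s * d) * b ≡ t * ((s * - t) * (b * d))
  rearrange s t b d t²≡1 = begin
    (- s * d) * b                   ≡⟨ left s b d ⟩
    1ℤ * - (s * (b * d))            ≡⟨ cong (_* - (s * (b * d))) t²≡1 ⟨
    (t * t) * - (s * (b * d))       ≡⟨ right s t b d ⟨
    t * ((s * - t) * (b * d))       ∎
    where
    left : ∀ s b d → (- s * d) * b ≡ 1ℤ * - (s * (b * d))
    left = solve-∀
    right : ∀ s t b d → t * ((s * - t) * (b * d)) ≡ (t * t) * - (s * (b * d))
    right = solve-∀

-- Interval matrices of forests

≡ᵇ⇒≡ : ∀ {p x} → (p ℕ.≡ᵇ x) ≡ true → p ≡ x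
≡ᵇ⇒≡ {p} {x} eq = ℕP.≡ᵇ⇒≡ p x (subst T (sym eq) tt)

≡ᵇ-false⇒≢ : ∀ {p x} → (p ℕ.≡ᵇ x) ≡ false → p ≢ x
≡ᵇ-false⇒≢ {p} {x} eq p≡x with () ← trans (sym eq) (dec-true (p ℕ.≟ x) p≡x)

step : ℕ → ℕ → ℤ
step zero    c       = 1ℤ
step (suc p) zero    = 0ℤ
step (suc p) (suc c) = step p c

δ : ℕ → ℕ → ℤ
δ p x = if p ℕ.≡ᵇ x then 1ℤ else 0ℤ

step-zero : ∀ p → step p 0 ≡ δ p 0
step-zero zero    = refl
step-zero (suc p) = refl

step-suc : ∀ p x → step p (suc x) ≡ step p x + δ p (suc x)
step-suc zero          x       = refl
step-suc (suc zero)    zero    = refl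
step-suc (suc (suc p)) zero    = refl
step-suc (suc p)       (suc x) = step-suc p x

step-≤ : ∀ {p c} → p ≤ c → step p c ≡ 1ℤ
step-≤ {zero}  _         = refl
step-≤ {suc p} (s≤s p≤c) = step-≤ p≤c

step-≡-if : ∀ p c → step p c ≡ (if does (c ℕ.<? p) then 0ℤ else 1ℤ)
step-≡-if zero    c       = refl
step-≡-if (suc p) zero    = refl
step-≡-if (suc p) (suc c) = step-≡-if p c

-- Row i is the root ε_{a i} − ε_{b i}: its entry in column c is [a i ≤ c] − [b i ≤ c].
intervalMatrix : ∀ {k m} → (Fin k → ℕ) → (Fin k → ℕ) → Fin k → Fin m → ℤ
intervalMatrix a b i c = step (a i) (toℕ c) - step (b i) (toℕ c)

coeff≡interval : ∀ {n} (i j : Fin (suc n)) (k : Fin n) → i < j →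
                 coeff (i , j) k ≡ step (toℕ i) (toℕ k) - step (toℕ j) (toℕ k)
coeff≡interval i j k i<j rewrite step-≡-if (toℕ i) (toℕ k) | step-≡-if (toℕ j) (toℕ k)
  with toℕ k ℕ.<ᵇ toℕ i | ℕP.<ᵇ-reflects-< (toℕ k) (toℕ i)
     | toℕ k ℕ.<ᵇ toℕ j | ℕP.<ᵇ-reflects-< (toℕ k) (toℕ j)
... | true  | _       | true  | _       = refl
... | true  | ofʸ k<i | false | ofⁿ k≮j = contradiction (ℕP.<-trans k<i i<j) k≮j
... | false | _       | true  | _       = refl
... | false | _       | false | _       = refl

incident : ℕ → ℕ → ℕ → Bool
incident x p q = (p ℕ.≡ᵇ x) ∨ (q ℕ.≡ᵇ x)

incidence : ℕ → ℕ → ℕ → ℤ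
incidence p q x = δ p x - δ q x

incidence-zero : ∀ p q → incidence p q 0 ≡ step p 0 - step q 0
incidence-zero p q = sym (cong₂ _-_ (step-zero p) (step-zero q))

incidence-suc : ∀ p q x → incidence p q (suc x) ≡ (step p (suc x) - step q (suc x)) - (step p x - step q x)
incidence-suc p q x = begin
  δ p (suc x) - δ q (suc x)
    ≡⟨ telescope (step p x) (step q x) (δ p (suc x)) (δ q (suc x)) ⟨
  ((step p x + δ p (suc x)) - (step q x + δ q (suc x))) - (step p x - step q x)
    ≡⟨ cong₂ (λ s t → (s - t) - (step p x - step q x)) (step-suc p x) (step-suc q x) ⟨
  (step p (suc x) - step q (suc x)) - (step p x - step q x) ∎
  where
  open ≡-Reasoning
  telescope : ∀ s t d e → ((s + d) - (t + e)) - (s - t) ≡ d - e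
  telescope = solve-∀

incidence-top : ∀ {p q m} → p ≤ suc m → q ≤ suc m → step p m - step q m ≡ - incidence p q (suc m)
incidence-top {p} {q} {m} p≤ q≤ = begin
  step p m - step q m
    ≡⟨ negate (step p m - step q m) ⟩
  - ((1ℤ - 1ℤ) - (step p m - step q m))
    ≡⟨ cong (λ d → - (d - (step p m - step q m))) (cong₂ _-_ (step-≤ p≤) (step-≤ q≤)) ⟨
  - ((step p (suc m) - step q (suc m)) - (step p m - step q m))
    ≡⟨ cong -_ (incidence-suc p q m) ⟨
  - incidence p q (suc m) ∎
  where
  open ≡-Reasoning
  negate : ∀ d → d ≡ - ((1ℤ - 1ℤ) - d)
  negate = solve-∀

incidence-off : ∀ {x p q} → incident x p q ≡ false → incidence p q x ≡ 0ℤ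
incidence-off {x} {p} {q} off with p ℕ.≡ᵇ x | q ℕ.≡ᵇ x
... | false | false = refl

incidence-on : ∀ {x p q} → p ≢ q → incident x p q ≡ true → IsUnit (incidence p q x)
incidence-on {x} {p} {q} p≢q on with p ℕ.≡ᵇ x in p≡x | q ℕ.≡ᵇ x in q≡x
... | true  | true  = contradiction (trans (≡ᵇ⇒≡ p≡x) (sym (≡ᵇ⇒≡ q≡x))) p≢q
... | true  | false = inj₁ refl
... | false | true  = inj₂ refl

-- Vertices are kept in ℕ, so that deleting a vertex u is the relabelling punchOutℕ u.
punchInℕ : ℕ → ℕ → ℕ
punchInℕ zero    y       = suc y
punchInℕ (suc u) zero    = zero
punchInℕ (suc u) (suc y) = suc (punchInℕ u y)

punchOutℕ : ℕ → ℕ → ℕ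
punchOutℕ zero    x       = ℕ.pred x
punchOutℕ (suc u) zero    = zero
punchOutℕ (suc u) (suc x) = suc (punchOutℕ u x)

punchInℕ-< : ∀ {u y} → y ℕ.< u → punchInℕ u y ≡ y
punchInℕ-< {suc u} {zero}  _         = refl
punchInℕ-< {suc u} {suc y} (s≤s y<u) = cong suc (punchInℕ-< y<u)

toℕ-punchIn : ∀ {m} (i : Fin (suc m)) (j : Fin m) → toℕ (punchIn i j) ≡ punchInℕ (toℕ i) (toℕ j)
toℕ-punchIn zero    j       = refl
toℕ-punchIn (suc i) zero    = refl
toℕ-punchIn (suc i) (suc j) = cong suc (toℕ-punchIn i j)

step-punchInℕ : ∀ {p u} y → p ≢ u → step p (punchInℕ u y) ≡ step (punchOutℕ u p) y
step-punchInℕ {zero}  {zero}  y       p≢u = contradiction refl p≢u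
step-punchInℕ {suc p} {zero}  y       _   = refl
step-punchInℕ {zero}  {suc u} zero    _   = refl
step-punchInℕ {suc p} {suc u} zero    _   = refl
step-punchInℕ {zero}  {suc u} (suc y) _   = refl
step-punchInℕ {suc p} {suc u} (suc y) p≢u = step-punchInℕ y (p≢u ∘ cong suc)

≡ᵇ-punchOutℕ : ∀ {u p x} → p ≢ u → x ≢ u → (p ℕ.≡ᵇ x) ≡ (punchOutℕ u p ℕ.≡ᵇ punchOutℕ u x)
≡ᵇ-punchOutℕ {zero}  {zero}  {x}     p≢u _   = contradiction refl p≢u
≡ᵇ-punchOutℕ {zero}  {suc p} {zero}  _   x≢u = contradiction refl x≢u
≡ᵇ-punchOutℕ {zero}  {suc p} {suc x} _   _   = refl
≡ᵇ-punchOutℕ {suc u} {zero}  {zero}  _   _   = refl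
≡ᵇ-punchOutℕ {suc u} {zero}  {suc x} _   _   = refl
≡ᵇ-punchOutℕ {suc u} {suc p} {zero}  _   _   = refl
≡ᵇ-punchOutℕ {suc u} {suc p} {suc x} p≢u x≢u = ≡ᵇ-punchOutℕ (p≢u ∘ cong suc) (x≢u ∘ cong suc)

punchOutℕ-mono-< : ∀ {u a b} → a ℕ.< b → a ≢ u → b ≢ u → punchOutℕ u a ℕ.< punchOutℕ u b
punchOutℕ-mono-< {zero}  {zero}  a<b a≢u _ = contradiction refl a≢u
punchOutℕ-mono-< {zero}  {suc a} {suc b} (s≤s a<b) _ _ = a<b
punchOutℕ-mono-< {suc u} {zero}  {suc b} _ _ _ = s≤s z≤n
punchOutℕ-mono-< {suc u} {suc a} {suc b} (s≤s a<b) a≢u b≢u =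
  s≤s (punchOutℕ-mono-< a<b (a≢u ∘ cong suc) (b≢u ∘ cong suc))

punchOutℕ-bound : ∀ {m u b} → b ≤ suc m → u ≤ suc m → b ≢ u → punchOutℕ u b ≤ m
punchOutℕ-bound {u = zero}  {zero}  _ _ b≢u = contradiction refl b≢u
punchOutℕ-bound {u = zero}  {suc b} (s≤s b≤m) _ _ = b≤m
punchOutℕ-bound {u = suc u} {zero}  _ _ _ = z≤n
punchOutℕ-bound {zero}  {suc u} {suc b} (s≤s z≤n) (s≤s z≤n) b≢u = contradiction refl b≢u
punchOutℕ-bound {suc m} {suc u} {suc b} (s≤s b≤) (s≤s u≤) b≢u = s≤s (punchOutℕ-bound b≤ u≤ (b≢u ∘ cong suc))

degree : ∀ {k} (a b : Fin k → ℕ) (H : Fin k → Bool) (x : ℕ) → ℕ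
degree a b H x = countFin (λ i → H i ∧ incident x (a i) (b i))

Leafless : ∀ {k} (a b : Fin k → ℕ) (H : Fin k → Bool) → Set
Leafless a b H = ∀ x → degree a b H x ≢ 1

-- A graph is a forest iff every nonempty set of its edges has a vertex of degree one.
Forest : ∀ {k} (a b : Fin k → ℕ) → Set
Forest a b = ∀ H → Leafless a b H → ∀ i → H i ≡ false

incident-false : ∀ {x p q} → incident x p q ≡ false → p ≢ x × q ≢ x
incident-false {x} {p} {q} off with p ℕ.≡ᵇ x in p≡x | q ℕ.≡ᵇ x in q≡x
... | false | false = ≡ᵇ-false⇒≢ p≡x , ≡ᵇ-false⇒≢ q≡x

forest-removeAt : ∀ {k} (a b : Fin (suc k) → ℕ) (r : Fin (suc k)) →
                  (∀ H → H r ≡ false → Leafless a b H → ∀ i → H i ≡ false) →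
                  Forest (a ∘ punchIn r) (b ∘ punchIn r)
forest-removeAt a b r avoid H′ leafless′ i =
  trans (sym (VFP.insertAt-punchIn H′ r false i))
        (avoid H (VFP.insertAt-lookup H′ r false) leafless (punchIn r i))
  where
  H : Fin _ → Bool
  H = insertAt H′ r false
  degree≡ : ∀ x → degree a b H x ≡ degree (a ∘ punchIn r) (b ∘ punchIn r) H′ x
  degree≡ x = trans (count-remove r (λ i → H i ∧ incident x (a i) (b i)))
    (cong₂ ℕ._+_ (cong (λ h → indicator (h ∧ incident x (a r) (b r))) (VFP.insertAt-lookup H′ r false))
                 (count-cong (λ i → cong (_∧ incident x (a (punchIn r i)) (b (punchIn r i))) (VFP.insertAt-punchIn H′ r false i))))
  leafless : Leafless a b H
  leafless x = leafless′ x ∘ trans (sym (degree≡ x))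

forest-punchOutℕ : ∀ {k} (a b : Fin k → ℕ) (u : ℕ) → (∀ i → incident u (a i) (b i) ≡ false) →
                   Forest a b → Forest (punchOutℕ u ∘ a) (punchOutℕ u ∘ b)
forest-punchOutℕ a b u isolated forest H leafless′ = forest H leafless
  where
  degree-u : degree a b H u ≡ 0
  degree-u = count-zero _ (λ i → trans (cong (H i ∧_) (isolated i)) (∧-zeroʳ (H i)))
  degree≡ : ∀ x → x ≢ u → degree a b H x ≡ degree (punchOutℕ u ∘ a) (punchOutℕ u ∘ b) H (punchOutℕ u x)
  degree≡ x x≢u = count-cong (λ i → let (a≢u , b≢u) = incident-false (isolated i) in
    cong (H i ∧_) (cong₂ _∨_ (≡ᵇ-punchOutℕ a≢u x≢u) (≡ᵇ-punchOutℕ b≢u x≢u)))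
  leafless : Leafless a b H
  leafless x with x ℕ.≟ u
  ... | yes refl = λ deg≡1 → contradiction (trans (sym degree-u) deg≡1) λ ()
  ... | no x≢u   = leafless′ (punchOutℕ u x) ∘ trans (sym (degree≡ x x≢u))

incident-≢ : ∀ {x p q} → p ≢ x → q ≢ x → incident x p q ≡ false
incident-≢ {x} {p} {q} p≢x q≢x = cong₂ _∨_ (dec-false (p ℕ.≟ x) p≢x) (dec-false (q ℕ.≟ x) q≢x)

forest-leaf : ∀ {k m} (a b : Fin (suc k) → ℕ) → (∀ i → a i ℕ.< b i) → (∀ i → b i ≤ m) → Forest a b →
              ∃ λ u → u ≤ m × degree a b (λ _ → true) u ≡ 1
forest-leaf {m = m} a b a<b b≤m forest with FP.any? (λ (x : Fin (suc m)) → degree a b (λ _ → true) (toℕ x) ℕ.≟ 1)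
... | yes (x , deg≡1) = toℕ x , ℕP.≤-pred (FP.toℕ<n x) , deg≡1
... | no ∄leaf = contradiction (forest (λ _ → true) leafless zero) λ ()
  where
  leafless : Leafless a b (λ _ → true)
  leafless x deg≡1 with x ℕ.<? suc m
  ... | yes x≤m = ∄leaf (fromℕ< x≤m , subst (λ y → degree a b (λ _ → true) y ≡ 1) (sym (FP.toℕ-fromℕ< x≤m)) deg≡1)
  ... | no  x≰m = contradiction (trans (sym (count-zero _ isolated)) deg≡1) λ ()
    where
    isolated : ∀ i → incident x (a i) (b i) ≡ false
    isolated i = incident-≢ (ℕP.<⇒≢ (ℕP.<-trans (a<b i) b<x)) (ℕP.<⇒≢ b<x)
      where
      b<x : b i ℕ.< x
      b<x = ℕP.≤-<-trans (b≤m i) (ℕP.≮⇒≥ x≰m)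

-- Column operations that turn one column of an interval matrix into ± the incidence vector of
-- vertex u; the remaining columns are untouched and correspond to the vertices other than u.
record PivotColumn {m} (a b : Fin (suc m) → ℕ) (u : ℕ) : Set where
  field
    col       : Fin (suc m)
    matrix    : Mat (suc m)
    det-eq    : det (intervalMatrix a b) ≡ det matrix
    sign      : ℤ
    sign-unit : IsUnit sign
    at-col    : ∀ i → matrix i col ≡ sign * incidence (a i) (b i) u
    off-col   : ∀ i y → matrix i (punchIn col y) ≡ intervalMatrix a b i (punchIn col y)
    relabel   : ∀ y → toℕ (punchIn col y) ≡ punchInℕ u (toℕ y)

pivotColumn : ∀ {m} (a b : Fin (suc m) → ℕ) → (∀ i → a i ℕ.< b i) → (∀ i → b i ≤ suc m) →
              ∀ u → u ≤ suc m → PivotColumn a b u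
pivotColumn a b a<b b≤ zero _ = record
  { col = zero ; matrix = intervalMatrix a b ; det-eq = refl ; sign = 1ℤ ; sign-unit = inj₁ refl
  ; at-col = λ i → trans (sym (incidence-zero (a i) (b i))) (sym (ℤP.*-identityˡ _))
  ; off-col = λ _ _ → refl ; relabel = λ _ → refl }
pivotColumn {m} a b a<b b≤ (suc u) u<m+1 with u ℕ.≟ m
... | yes refl = record
  { col = fromℕ m ; matrix = intervalMatrix a b ; det-eq = refl ; sign = -1ℤ ; sign-unit = inj₂ refl
  ; at-col = at-col ; off-col = λ _ _ → refl ; relabel = relabel }
  where
  at-col : ∀ i → intervalMatrix a b i (fromℕ m) ≡ -1ℤ * incidence (a i) (b i) (suc m)
  at-col i = begin
    step (a i) (toℕ (fromℕ m)) - step (b i) (toℕ (fromℕ m))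
      ≡⟨ cong (λ c → step (a i) c - step (b i) c) (FP.toℕ-fromℕ m) ⟩
    step (a i) m - step (b i) m
      ≡⟨ incidence-top (ℕP.<⇒≤ (ℕP.<-≤-trans (a<b i) (b≤ i))) (b≤ i) ⟩
    - incidence (a i) (b i) (suc m)
      ≡⟨ ℤP.-1*i≡-i _ ⟨
    -1ℤ * incidence (a i) (b i) (suc m) ∎
    where open ≡-Reasoning
  relabel : ∀ y → toℕ (punchIn (fromℕ m) y) ≡ punchInℕ (suc m) (toℕ y)
  relabel y = begin
    toℕ (punchIn (fromℕ m) y)         ≡⟨ toℕ-punchIn (fromℕ m) y ⟩
    punchInℕ (toℕ (fromℕ m)) (toℕ y)  ≡⟨ cong (λ c → punchInℕ c (toℕ y)) (FP.toℕ-fromℕ m) ⟩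
    punchInℕ m (toℕ y)                ≡⟨ punchInℕ-< (FP.toℕ<n y) ⟩
    toℕ y                             ≡⟨ punchInℕ-< (ℕP.m<n⇒m<1+n (FP.toℕ<n y)) ⟨
    punchInℕ (suc m) (toℕ y)          ∎
    where open ≡-Reasoning
... | no u≢m = record
  { col = suc a₀ ; matrix = M ; det-eq = sym (det-subtract-adjacent-col A a₀) ; sign = 1ℤ ; sign-unit = inj₁ refl
  ; at-col = at-col ; off-col = λ i y → VFP.updateAt-minimal _ (suc a₀) (A i) (FP.punchInᵢ≢i (suc a₀) y)
  ; relabel = λ y → trans (toℕ-punchIn (suc a₀) y) (cong (λ c → punchInℕ (suc c) (toℕ y)) toℕ-a₀) }
  where
  A : Mat _
  A = intervalMatrix a b
  u<m : u ℕ.< m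
  u<m = ℕP.≤∧≢⇒< (ℕP.≤-pred u<m+1) u≢m
  a₀ : Fin m
  a₀ = fromℕ< u<m
  toℕ-a₀ : toℕ a₀ ≡ u
  toℕ-a₀ = FP.toℕ-fromℕ< u<m
  M : Mat _
  M i = updateAt (A i) (suc a₀) (_- A i (inject₁ a₀))
  at-col : ∀ i → M i (suc a₀) ≡ 1ℤ * incidence (a i) (b i) (suc u)
  at-col i = begin
    M i (suc a₀)
      ≡⟨ VFP.updateAt-updates (suc a₀) (A i) ⟩
    A i (suc a₀) - A i (inject₁ a₀)
      ≡⟨ cong₂ (λ c c′ → (step (a i) c - step (b i) c) - (step (a i) c′ - step (b i) c′))
               (cong suc toℕ-a₀) (trans (FP.toℕ-inject₁ a₀) toℕ-a₀) ⟩
    (step (a i) (suc u) - step (b i) (suc u)) - (step (a i) u - step (b i) u)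
      ≡⟨ incidence-suc (a i) (b i) u ⟨
    incidence (a i) (b i) (suc u)
      ≡⟨ ℤP.*-identityˡ _ ⟨
    1ℤ * incidence (a i) (b i) (suc u) ∎
    where open ≡-Reasoning

module _ {m} {a b : Fin (suc m) → ℕ} {u} (P : PivotColumn a b u) where
  open PivotColumn P

  pivotColumn-expand : ∀ r → (∀ i → i ≢ r → incident u (a i) (b i) ≡ false) →
                       det (intervalMatrix a b) ≡ (sgn r * sgn col) * (matrix r col * det (minor r col matrix))
  pivotColumn-expand r isolated =
    trans det-eq (trans (det-expand-col matrix col)
      (sum-single r (λ i → (sgn i * sgn col) * (matrix i col * det (minor i col matrix))) vanish))
    where
    vanish : ∀ x → x ≢ r → (sgn x * sgn col) * (matrix x col * det (minor x col matrix)) ≡ 0ℤ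
    vanish x x≢r = begin
      (sgn x * sgn col) * (matrix x col * det (minor x col matrix))
        ≡⟨ cong (λ e → (sgn x * sgn col) * (e * det (minor x col matrix))) (at-col x) ⟩
      (sgn x * sgn col) * ((sign * incidence (a x) (b x) u) * det (minor x col matrix))
        ≡⟨ cong (λ e → (sgn x * sgn col) * ((sign * e) * det (minor x col matrix)))
                (incidence-off {u} {a x} {b x} (isolated x x≢r)) ⟩
      (sgn x * sgn col) * ((sign * 0ℤ) * det (minor x col matrix))
        ≡⟨ annihilate (sgn x * sgn col) sign (det (minor x col matrix)) ⟩
      0ℤ ∎
      where
      open ≡-Reasoning
      annihilate : ∀ s t d → s * ((t * 0ℤ) * d) ≡ 0ℤ
      annihilate = solve-∀

  pivotColumn-minor : ∀ r → (∀ x → a (punchIn r x) ≢ u × b (punchIn r x) ≢ u) →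
                      ∀ x y → minor r col matrix x y ≡ intervalMatrix (punchOutℕ u ∘ a ∘ punchIn r) (punchOutℕ u ∘ b ∘ punchIn r) x y
  pivotColumn-minor r apart x y = begin
    matrix (punchIn r x) (punchIn col y)
      ≡⟨ off-col (punchIn r x) y ⟩
    step (a (punchIn r x)) (toℕ (punchIn col y)) - step (b (punchIn r x)) (toℕ (punchIn col y))
      ≡⟨ cong (λ c → step (a (punchIn r x)) c - step (b (punchIn r x)) c) (relabel y) ⟩
    step (a (punchIn r x)) (punchInℕ u (toℕ y)) - step (b (punchIn r x)) (punchInℕ u (toℕ y))
      ≡⟨ cong₂ _-_ (step-punchInℕ (toℕ y) (proj₁ (apart x))) (step-punchInℕ (toℕ y) (proj₂ (apart x))) ⟩
    intervalMatrix (punchOutℕ u ∘ a ∘ punchIn r) (punchOutℕ u ∘ b ∘ punchIn r) x y ∎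
    where open ≡-Reasoning

forest-det : ∀ {m} (a b : Fin m → ℕ) → (∀ i → a i ℕ.< b i) → (∀ i → b i ≤ m) → Forest a b →
             IsUnit (det (intervalMatrix a b))
forest-det {zero}  _ _ _ _ _ = inj₁ refl
forest-det {suc m} a b a<b b≤ forest with forest-leaf a b a<b b≤ forest
... | u , u≤ , leaf with count≡1⇒unique _ leaf
... | r , r-at-u , isolated = subst IsUnit (sym (pivotColumn-expand P r isolated))
        (IsUnit-* (IsUnit-* (IsUnit-signℤ (toℕ r)) (IsUnit-signℤ (toℕ col))) (IsUnit-* pivot-unit minor-unit))
  where
  P : PivotColumn a b u
  P = pivotColumn a b a<b b≤ u u≤
  open PivotColumn P
  isolated′ : ∀ x → incident u (a (punchIn r x)) (b (punchIn r x)) ≡ false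
  isolated′ x = isolated (punchIn r x) (FP.punchInᵢ≢i r x)
  apart : ∀ x → a (punchIn r x) ≢ u × b (punchIn r x) ≢ u
  apart x = incident-false {u} {a (punchIn r x)} {b (punchIn r x)} (isolated′ x)
  pivot-unit : IsUnit (matrix r col)
  pivot-unit = subst IsUnit (sym (at-col r)) (IsUnit-* sign-unit (incidence-on (ℕP.<⇒≢ (a<b r)) r-at-u))
  minor-unit : IsUnit (det (minor r col matrix))
  minor-unit = subst IsUnit (sym (det-cong (pivotColumn-minor P r apart)))
    (forest-det (punchOutℕ u ∘ a ∘ punchIn r) (punchOutℕ u ∘ b ∘ punchIn r)
      (λ x → punchOutℕ-mono-< (a<b (punchIn r x)) (proj₁ (apart x)) (proj₂ (apart x)))
      (λ x → punchOutℕ-bound (b≤ (punchIn r x)) u≤ (proj₂ (apart x)))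
      (forest-punchOutℕ (a ∘ punchIn r) (b ∘ punchIn r) u isolated′ (forest-removeAt a b r (λ H _ → forest H))))

-- Left kernels of interval matrices

support : ∀ {k} → (Fin k → ℤ) → Fin k → Bool
support y i = not (does (y i ℤ.≟ 0ℤ))

support-false : ∀ {k} (y : Fin k → ℤ) i → support y i ≡ false → y i ≡ 0ℤ
support-false y i off with y i ℤ.≟ 0ℤ
... | yes y≡0 = y≡0

support-true : ∀ {k} (y : Fin k → ℤ) i → support y i ≡ true → y i ≢ 0ℤ
support-true y i on with y i ℤ.≟ 0ℤ
... | no y≢0 = y≢0

module _ {k n} (a b : Fin k → ℕ) (a<b : ∀ i → a i ℕ.< b i) (b≤n : ∀ i → b i ≤ n) (y : Fin k → ℤ)
         (kernel : LeftKernel (intervalMatrix {m = n} a b) y) where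

  column : ℕ → Fin k → ℤ
  column c i = y i * (step (a i) c - step (b i) c)

  cut : ℕ → ℤ
  cut c = sum (column c)

  cut≡0 : ∀ c → cut c ≡ 0ℤ
  cut≡0 c with c ℕ.<? n
  ... | yes c<n = trans (sum-cong-≗ (λ i → cong (λ c′ → column c′ i) (sym (FP.toℕ-fromℕ< c<n)))) (kernel (fromℕ< c<n))
  ... | no  c≮n = sum-zero (column c) above
    where
    b≤c : ∀ i → b i ≤ c
    b≤c i = ℕP.≤-trans (b≤n i) (ℕP.≮⇒≥ c≮n)
    a≤c : ∀ i → a i ≤ c
    a≤c i = ℕP.<⇒≤ (ℕP.<-≤-trans (a<b i) (b≤c i))
    above : ∀ i → column c i ≡ 0ℤ
    above i = trans (cong (y i *_) (ℤP.i≡j⇒i-j≡0 (trans (step-≤ (a≤c i)) (sym (step-≤ (b≤c i)))))) (ℤP.*-zeroʳ (y i))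

  flow≡0 : ∀ x → sum (λ i → y i * incidence (a i) (b i) x) ≡ 0ℤ
  flow≡0 zero = trans (sum-cong-≗ (λ i → cong (y i *_) (incidence-zero (a i) (b i)))) (cut≡0 0)
  flow≡0 (suc x) = begin
    sum (λ i → y i * incidence (a i) (b i) (suc x))
      ≡⟨ sum-cong-≗ (λ i → trans (cong (y i *_) (incidence-suc (a i) (b i) x)) (distrib (y i) _ _)) ⟩
    sum (λ i → column (suc x) i - column x i)
      ≡⟨ ∑-distrib-minus (column (suc x)) (column x) ⟩
    cut (suc x) - cut x
      ≡⟨ cong₂ _-_ (cut≡0 (suc x)) (cut≡0 x) ⟩
    0ℤ ∎
    where
    open ≡-Reasoning
    distrib : ∀ z s t → z * (s - t) ≡ z * s - z * t
    distrib = solve-∀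

  leftKernel-leafless : Leafless a b (support y)
  leftKernel-leafless x deg≡1 with count≡1⇒unique _ deg≡1
  ... | r , r-on , others-off = support-true y r (∧-conicalˡ _ _ r-on) y-r≡0
    where
    flow-r : sum (λ i → y i * incidence (a i) (b i) x) ≡ y r * incidence (a r) (b r) x
    flow-r = sum-single r (λ i → y i * incidence (a i) (b i) x) (λ i i≢r → off i (others-off i i≢r))
      where
      off : ∀ i → support y i ∧ incident x (a i) (b i) ≡ false → y i * incidence (a i) (b i) x ≡ 0ℤ
      off i not-both with support y i in supp | not-both
      ... | false | _         = trans (cong (_* incidence (a i) (b i) x) (support-false y i supp)) (ℤP.*-zeroˡ (incidence (a i) (b i) x))
      ... | true  | inc≡false = trans (cong (y i *_) (incidence-off {x} {a i} {b i} inc≡false)) (ℤP.*-zeroʳ (y i))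
    y-r≡0 : y r ≡ 0ℤ
    y-r≡0 = IsUnit-cancelʳ-zero (incidence-on (ℕP.<⇒≢ (a<b r)) (∧-conicalʳ _ _ r-on)) (y r)
              (trans (sym flow-r) (flow≡0 x))

-- Cycles

nextC-view : ∀ {m} (i : Fin (suc m)) →
             (toℕ i ℕ.< m × toℕ (nextC i) ≡ suc (toℕ i)) ⊎ (toℕ i ≡ m × nextC i ≡ zero)
nextC-view {zero}  zero = inj₂ (refl , refl)
nextC-view {suc m} zero = inj₁ (s≤s z≤n , refl)
nextC-view {suc m} (suc i) with nextC {m} i | nextC-view i
... | zero  | inj₁ (_ , ())
... | zero  | inj₂ (i≡m , _) = inj₂ (cong suc i≡m , refl)
... | suc j | inj₁ (i<m , eq) = inj₁ (s≤s i<m , cong suc eq)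

toℕ-nextC : ∀ {m} (i : Fin (suc m)) → toℕ i ℕ.< m → toℕ (nextC i) ≡ suc (toℕ i)
toℕ-nextC i i<m with nextC-view i
... | inj₁ (_ , eq) = eq
... | inj₂ (i≡m , _) = contradiction i≡m (ℕP.<⇒≢ i<m)

nextC-last : ∀ {m} (i : Fin (suc m)) → toℕ i ≡ m → nextC i ≡ zero
nextC-last i i≡m with nextC-view i
... | inj₁ (i<m , _) = contradiction i≡m (ℕP.<⇒≢ i<m)
... | inj₂ (_ , eq) = eq

nextC-injective : ∀ {m} → Injective _≡_ _≡_ (nextC {m})
nextC-injective {m} {i} {j} eq with nextC-view i | nextC-view j
... | inj₁ (_ , i⁺) | inj₁ (_ , j⁺) = FP.toℕ-injective (ℕP.suc-injective (trans (sym i⁺) (trans (cong toℕ eq) j⁺)))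
... | inj₁ (_ , i⁺) | inj₂ (_ , j⁺) with () ← trans (sym i⁺) (cong toℕ (trans eq j⁺))
nextC-injective {m} {i} {j} eq | inj₂ (_ , i⁺) | inj₁ (_ , j⁺) with () ← trans (sym j⁺) (cong toℕ (trans (sym eq) i⁺))
nextC-injective {m} {i} {j} eq | inj₂ (i≡m , _) | inj₂ (j≡m , _) = FP.toℕ-injective (trans i≡m (sym j≡m))

nextC-surjective : ∀ {m} (k : Fin (suc m)) → ∃ λ i → nextC i ≡ k
nextC-surjective {m} zero = fromℕ m , nextC-last (fromℕ m) (FP.toℕ-fromℕ m)
nextC-surjective {suc m} (suc k) =
  inject₁ k , FP.toℕ-injective (trans (toℕ-nextC (inject₁ k) inject₁k<) (cong suc (FP.toℕ-inject₁ k)))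
  where
  inject₁k< : toℕ (inject₁ k) ℕ.< suc m
  inject₁k< = subst (ℕ._< suc m) (sym (FP.toℕ-inject₁ k)) (FP.toℕ<n k)

sum-nextC : ∀ {m} (f : Fin (suc m) → ℤ) → sum f ≡ sum (f ∘ nextC)
sum-nextC f = sum-injective-reindex nextC f nextC-injective (λ k k∉ → contradiction (proj₂ (nextC-surjective k)) (k∉ _))

nextC≢id : ∀ {m} (i : Fin (suc m)) → 1 ≤ m → nextC i ≢ i
nextC≢id i 1≤m eq with nextC-view i
... | inj₁ (_ , i⁺) = ℕP.1+n≢n (trans (sym i⁺) (cong toℕ eq))
... | inj₂ (i≡m , i⁺) with () ← subst (1 ≤_) (trans (sym i≡m) (cong toℕ (trans (sym eq) i⁺))) 1≤m

nextC²≢id : ∀ {m} (i : Fin (suc m)) → 2 ≤ m → nextC (nextC i) ≢ i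
nextC²≢id {m} i 2≤m eq with nextC-view i
... | inj₂ (i≡m , i⁺) = ℕP.>⇒≢ 2≤m (begin
  m                     ≡⟨ i≡m ⟨
  toℕ i                 ≡⟨ cong toℕ (trans (sym eq) (cong nextC i⁺)) ⟩
  toℕ (nextC {m} zero)  ≡⟨ toℕ-nextC zero (ℕP.<-≤-trans (s≤s z≤n) 2≤m) ⟩
  1                     ∎)
  where open ≡-Reasoning
... | inj₁ (i<m , i⁺) with nextC-view (nextC i)
...   | inj₁ (_ , i⁺⁺) = ℕP.<⇒≢ (ℕP.m<n⇒m<1+n (ℕP.n<1+n (toℕ i)))
                           (trans (cong toℕ (sym eq)) (trans i⁺⁺ (cong suc i⁺)))
...   | inj₂ (i⁺≡m , i⁺⁺) =
  ℕP.>⇒≢ 2≤m (trans (sym i⁺≡m) (trans i⁺ (cong suc (cong toℕ (trans (sym eq) i⁺⁺)))))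

record Cycle {N} (R : Fin N → Fin N → Set) : Set where
  field
    len       : ℕ
    vertex    : Fin (suc len) → Fin N
    long      : 3 ≤ suc len
    injective : Injective _≡_ _≡_ vertex
    adjacent  : ∀ s → R (vertex s) (vertex (nextC s))

Repeats : ∀ {N} → (ℕ → Fin N) → ℕ → Set
Repeats X j = ∃ λ (i : Fin j) → X (toℕ i) ≡ X j

repeats? : ∀ {N} (X : ℕ → Fin N) j → Dec (Repeats X j)
repeats? X j = FP.any? (λ i → X (toℕ i) F.≟ X j)

opaque
  -- Pigeonhole on the first N + 1 steps, then the least index at which a vertex recurs.  Opaque, so
  -- that checking the cycle built from it does not unfold the search.
  firstRepeat : ∀ {N} (X : ℕ → Fin N) →
                ∃₂ λ i d → X i ≡ X (suc (i ℕ.+ d)) × (∀ p q → p ℕ.< q → q ≤ i ℕ.+ d → X p ≢ X q)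
  firstRepeat {N} X with FP.pigeonhole (ℕP.n<1+n N) (X ∘ toℕ)
  ... | i , j , i<j , Xi≡Xj with FP.¬∀⟶∃¬-smallest (suc N) (λ j → ¬ Repeats X (toℕ j)) (¬? ∘ repeats? X ∘ toℕ)
                                   (λ none → none j (fromℕ< i<j , trans (cong X (FP.toℕ-fromℕ< i<j)) Xi≡Xj))
  ... | J , ¬¬repeats , earlier with decidable-stable (repeats? X (toℕ J)) ¬¬repeats
  ... | I , XI≡XJ with ℕP.m≤n⇒∃[o]m+o≡n (FP.toℕ<n I)
  ... | d , J≡ = toℕ I , d , trans XI≡XJ (cong X (sym J≡)) , distinct
    where
    distinct : ∀ p q → p ℕ.< q → q ≤ toℕ I ℕ.+ d → X p ≢ X q
    distinct p q p<q q≤ Xp≡Xq =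
      earlier (fromℕ< q<J) (subst (Repeats X) (sym toℕ-q) (fromℕ< p<q , trans (cong X (FP.toℕ-fromℕ< p<q)) Xp≡Xq))
      where
      q<J : q ℕ.< toℕ J
      q<J = subst (q ℕ.<_) J≡ (s≤s q≤)
      toℕ-q : toℕ (inject (fromℕ< q<J)) ≡ q
      toℕ-q = trans (FP.toℕ-inject (fromℕ< q<J)) (FP.toℕ-fromℕ< q<J)

nonBacktracking-cycle : ∀ {N} {R : Fin N → Fin N → Set} (X : ℕ → Fin N) →
                        (∀ t → R (X t) (X (suc t))) → (∀ t → X (suc t) ≢ X t) → (∀ t → X (suc (suc t)) ≢ X t) →
                        Cycle R
nonBacktracking-cycle {R = R} X moves stays returns with firstRepeat X
... | i₀ , d , closes , distinct =
  record { len = d ; vertex = w ; long = long ; injective = injective ; adjacent = adjacent }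
  where
  w : Fin (suc d) → Fin _
  w s = X (i₀ ℕ.+ toℕ s)
  within : ∀ s → i₀ ℕ.+ toℕ s ≤ i₀ ℕ.+ d
  within s = ℕP.+-monoʳ-≤ i₀ (ℕP.≤-pred (FP.toℕ<n s))
  injective : Injective _≡_ _≡_ w
  injective {s} {s′} eq with ℕP.<-cmp (toℕ s) (toℕ s′)
  ... | tri< s<s′ _ _ = contradiction eq (distinct _ _ (ℕP.+-monoʳ-< i₀ s<s′) (within s′))
  ... | tri≈ _ s≡s′ _ = FP.toℕ-injective s≡s′
  ... | tri> _ _ s>s′ = contradiction (sym eq) (distinct _ _ (ℕP.+-monoʳ-< i₀ s>s′) (within s))
  w-nextC : ∀ s → w (nextC s) ≡ X (suc (i₀ ℕ.+ toℕ s))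
  w-nextC s with nextC-view s
  ... | inj₁ (_ , s⁺) = cong X (trans (cong (i₀ ℕ.+_) s⁺) (ℕP.+-suc i₀ (toℕ s)))
  ... | inj₂ (s≡d , s⁺) = begin
    w (nextC s)
      ≡⟨ cong w s⁺ ⟩
    X (i₀ ℕ.+ 0)
      ≡⟨ cong X (ℕP.+-identityʳ i₀) ⟩
    X i₀
      ≡⟨ closes ⟩
    X (suc (i₀ ℕ.+ d))
      ≡⟨ cong (λ e → X (suc (i₀ ℕ.+ e))) s≡d ⟨
    X (suc (i₀ ℕ.+ toℕ s)) ∎
    where open ≡-Reasoning
  adjacent : ∀ s → R (w s) (w (nextC s))
  adjacent s = subst (R (w s)) (sym (w-nextC s)) (moves (i₀ ℕ.+ toℕ s))
  long : 3 ≤ suc d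
  long = atLeastTwo d closes
    where
    atLeastTwo : ∀ e → X i₀ ≡ X (suc (i₀ ℕ.+ e)) → 3 ≤ suc e
    atLeastTwo zero          c = ⊥-elim (stays i₀ (trans (cong (X ∘ suc) (sym (ℕP.+-identityʳ i₀))) (sym c)))
    atLeastTwo (suc zero)    c = ⊥-elim (returns i₀ (trans (cong (X ∘ suc) (ℕP.+-comm 1 i₀)) (sym c)))
    atLeastTwo (suc (suc _)) _ = s≤s (s≤s (s≤s z≤n))

Joins : ∀ {K N} → (Fin K → Edge N) → Fin K → Fin N → Fin N → Set
Joins S k x y = S k ≡ (x , y) ⊎ S k ≡ (y , x)

AdjIn : ∀ {K N} → (Fin K → Edge N) → (Fin K → Bool) → Fin N → Fin N → Set
AdjIn S H x y = ∃ λ k → H k ≡ true × Joins S k x y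

incident-tail : ∀ x q → incident x x q ≡ true
incident-tail x q = cong (_∨ (q ℕ.≡ᵇ x)) (dec-true (x ℕ.≟ x) refl)

incident-head : ∀ p x → incident x p x ≡ true
incident-head p x = trans (cong ((p ℕ.≡ᵇ x) ∨_) (dec-true (x ℕ.≟ x) refl)) (∨-zeroʳ (p ℕ.≡ᵇ x))

module SimpleGraph {K N} (S : Fin K → Edge N) (ordered : ∀ k → proj₁ (S k) < proj₂ (S k))
                   (S-inj : Injective _≡_ _≡_ S) where

  tails heads : Fin K → ℕ
  tails k = toℕ (proj₁ (S k))
  heads k = toℕ (proj₂ (S k))

  ordered-≡ : ∀ {k x y} → S k ≡ (x , y) → x < y
  ordered-≡ {k} eq = subst (λ e → proj₁ e < proj₂ e) eq (ordered k)

  Joins-sym : ∀ {k x y} → Joins S k x y → Joins S k y x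
  Joins-sym (inj₁ eq) = inj₂ eq
  Joins-sym (inj₂ eq) = inj₁ eq

  Joins-irrefl : ∀ {k x} → ¬ Joins S k x x
  Joins-irrefl (inj₁ eq) = ℕP.<-irrefl refl (ordered-≡ eq)
  Joins-irrefl (inj₂ eq) = ℕP.<-irrefl refl (ordered-≡ eq)

  Joins-unique : ∀ {k k′ x y} → Joins S k x y → Joins S k′ x y → k ≡ k′
  Joins-unique (inj₁ eq) (inj₁ eq′) = S-inj (trans eq (sym eq′))
  Joins-unique (inj₂ eq) (inj₂ eq′) = S-inj (trans eq (sym eq′))
  Joins-unique (inj₁ eq) (inj₂ eq′) = ⊥-elim (ℕP.<-asym (ordered-≡ eq) (ordered-≡ eq′))
  Joins-unique (inj₂ eq) (inj₁ eq′) = ⊥-elim (ℕP.<-asym (ordered-≡ eq) (ordered-≡ eq′))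

  Joins⇒incident : ∀ {k x y} → Joins S k x y → incident (toℕ x) (tails k) (heads k) ≡ true
  Joins⇒incident {x = x} {y} (inj₁ eq) rewrite eq = incident-tail (toℕ x) (toℕ y)
  Joins⇒incident {x = x} {y} (inj₂ eq) rewrite eq = incident-head (toℕ y) (toℕ x)

  incident⇒Joins : ∀ {k x} → incident (toℕ x) (tails k) (heads k) ≡ true → ∃ λ y → Joins S k x y
  incident⇒Joins {k} {x} at with tails k ℕ.≡ᵇ toℕ x in tail≡x
  ... | true  = proj₂ (S k) , inj₁ (cong (_, proj₂ (S k)) (FP.toℕ-injective (≡ᵇ⇒≡ tail≡x)))
  ... | false = proj₁ (S k) , inj₂ (cong (proj₁ (S k) ,_) (FP.toℕ-injective (≡ᵇ⇒≡ at)))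

  record Flag (H : Fin K → Bool) : Set where
    constructor flag
    field
      vertex : Fin N
      edge   : Fin K
      edge∈H : H edge ≡ true
      at     : incident (toℕ vertex) (tails edge) (heads edge) ≡ true

  module _ (H : Fin K → Bool) (leafless : Leafless tails heads H) where
    open Flag

    -- No vertex has degree one in H, so a walk can leave along an edge other than the one it came by.
    turn : (f : Flag H) → Σ (Flag H) λ f′ → edge f′ ≢ edge f × Joins S (edge f′) (vertex f) (vertex f′)
    turn (flag x e e∈H x∈e)
      with count≢1⇒another (λ k → H k ∧ incident (toℕ x) (tails k) (heads k)) e (leafless (toℕ x)) (cong₂ _∧_ e∈H x∈e)
    ... | e′ , e′≢e , e′∈H∧x∈e′ with incident⇒Joins {e′} {x} (∧-conicalʳ _ _ e′∈H∧x∈e′)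
    ... | y , joins = flag y e′ (∧-conicalˡ _ _ e′∈H∧x∈e′) (Joins⇒incident (Joins-sym joins)) , e′≢e , joins

    walk : Flag H → ℕ → Flag H
    walk f zero    = f
    walk f (suc t) = proj₁ (turn (walk f t))

    leafless-cycle : ∀ k → H k ≡ true → Cycle (AdjIn S H)
    leafless-cycle k k∈H = nonBacktracking-cycle X moves stays returns
      where
      start : Flag H
      start = flag (proj₁ (S k)) k k∈H (Joins⇒incident (inj₁ refl))
      X : ℕ → Fin N
      X = vertex ∘ walk start
      joins : ∀ t → Joins S (edge (walk start (suc t))) (X t) (X (suc t))
      joins t = proj₂ (proj₂ (turn (walk start t)))
      moves : ∀ t → AdjIn S H (X t) (X (suc t))
      moves t = edge (walk start (suc t)) , edge∈H (walk start (suc t)) , joins t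
      stays : ∀ t → X (suc t) ≢ X t
      stays t eq = Joins-irrefl (subst (Joins S _ (X t)) eq (joins t))
      returns : ∀ t → X (suc (suc t)) ≢ X t
      returns t eq = proj₁ (proj₂ (turn (walk start (suc t))))
        (sym (Joins-unique (joins t) (Joins-sym (subst (Joins S _ (X (suc t))) eq (joins (suc t))))))

  Joins⇔endpoints : ∀ {k x y} →
                    Joins S k x y ⇔ ((x ≡ proj₁ (S k) × y ≡ proj₂ (S k)) ⊎ (x ≡ proj₂ (S k) × y ≡ proj₁ (S k)))
  Joins⇔endpoints {k} = mk⇔ to from
    where
    to : ∀ {x y} → Joins S k x y → (x ≡ proj₁ (S k) × y ≡ proj₂ (S k)) ⊎ (x ≡ proj₂ (S k) × y ≡ proj₁ (S k))
    to (inj₁ eq) = inj₁ (cong proj₁ (sym eq) , cong proj₂ (sym eq))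
    to (inj₂ eq) = inj₂ (cong proj₂ (sym eq) , cong proj₁ (sym eq))
    from : ∀ {x y} → (x ≡ proj₁ (S k) × y ≡ proj₂ (S k)) ⊎ (x ≡ proj₂ (S k) × y ≡ proj₁ (S k)) → Joins S k x y
    from (inj₁ (refl , refl)) = inj₁ refl
    from (inj₂ (refl , refl)) = inj₂ refl

  Cycle⇒IsCycle : ∀ {H} (c : Cycle (AdjIn S H)) → IsCycle S (Cycle.vertex c)
  Cycle⇒IsCycle c = long , injective , λ s → let (k , _ , joins) = adjacent s in k , joins
    where open Cycle c

  Cycle-edge∈H : ∀ {H} (c : Cycle (AdjIn S H)) k → CycEdge (Cycle.vertex c) (proj₁ (S k)) (proj₂ (S k)) → H k ≡ true
  Cycle-edge∈H {H} c k (s , ends) with Cycle.adjacent c s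
  ... | k′ , k′∈H , joins = subst (λ j → H j ≡ true) (Joins-unique joins (Equivalence.from Joins⇔endpoints ends)) k′∈H

-- Signed maximal minors of a unicyclic edge set

isℤ⇒≡ : ∀ {x t} → isℤ x t ≡ true → x ≡ t
isℤ⇒≡ {x} {t} eq with x ℤ.≟ t
... | yes x≡t = x≡t

module EdgeList {n} (S : Fin (suc n) → Edge (suc n)) (ordered : ∀ k → proj₁ (S k) < proj₂ (S k))
                (S-inj : Injective _≡_ _≡_ S) where

  open SimpleGraph S ordered S-inj public

  coeffMatrix : Fin (suc n) → Fin n → ℤ
  coeffMatrix k = coeff (S k)

  coeffMatrix≡interval : ∀ k c → coeffMatrix k c ≡ intervalMatrix tails heads k c
  coeffMatrix≡interval k c = coeff≡interval (proj₁ (S k)) (proj₂ (S k)) c (ordered k)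

  heads≤n : ∀ k → heads k ≤ n
  heads≤n k = ℕP.≤-pred (FP.toℕ<n (proj₂ (S k)))

  dCoef-leftKernel : LeftKernel coeffMatrix (dCoef S)
  dCoef-leftKernel = signedMaximalMinors-leftKernel coeffMatrix

  ForestWithout : Fin (suc n) → Set
  ForestWithout k = ∀ H → H k ≡ false → Leafless tails heads H → ∀ k′ → H k′ ≡ false

  dCoef-unit : ∀ k → ForestWithout k → IsUnit (dCoef S k)
  dCoef-unit k forest = IsUnit-* (IsUnit-signℤ (suc (toℕ k)))
    (subst IsUnit (det-cong (λ r c → sym (coeffMatrix≡interval (punchIn k r) c)))
      (forest-det (tails ∘ punchIn k) (heads ∘ punchIn k) (ordered ∘ punchIn k) (heads≤n ∘ punchIn k)
                  (forest-removeAt tails heads k forest)))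

  leftKernel-vanishing : ∀ k → ForestWithout k → ∀ y → LeftKernel coeffMatrix y → y k ≡ 0ℤ → ∀ k′ → y k′ ≡ 0ℤ
  leftKernel-vanishing k forest y kernel y-k≡0 k′ = support-false y k′
    (forest (support y) (cong not (dec-true (y k ℤ.≟ 0ℤ) y-k≡0))
            (leftKernel-leafless tails heads ordered heads≤n y (LeftKernel-cong {y = y} coeffMatrix≡interval kernel)) k′)

  module CycleVector {m} (v : Fin (suc m) → Fin (suc n)) (cyc : IsCycle S v) where

    v-inj : Injective _≡_ _≡_ v
    v-inj = proj₁ (proj₂ cyc)

    2≤m : 2 ≤ m
    2≤m = ℕP.≤-pred (proj₁ cyc)

    κ : Fin (suc m) → Fin (suc n)
    κ i = proj₁ (proj₂ (proj₂ cyc) i)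

    κ-joins : ∀ i → Joins S (κ i) (v i) (v (nextC i))
    κ-joins i = proj₂ (proj₂ (proj₂ cyc) i)

    reversed : ∀ {i j : Fin (suc m)} → i ≡ nextC j → nextC i ≡ j → i ≡ j
    reversed {j = j} refl j⁺⁺≡j = contradiction j⁺⁺≡j (nextC²≢id j 2≤m)

    κ-injective : Injective _≡_ _≡_ κ
    κ-injective {i} {j} κi≡κj
      with Equivalence.to Joins⇔endpoints (κ-joins i)
         | Equivalence.to Joins⇔endpoints (subst (λ k → Joins S k (v j) (v (nextC j))) (sym κi≡κj) (κ-joins j))
    ... | inj₁ (vi≡p , _) | inj₁ (vj≡p , _) = v-inj (trans vi≡p (sym vj≡p))
    ... | inj₂ (vi≡q , _) | inj₂ (vj≡q , _) = v-inj (trans vi≡q (sym vj≡q))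
    ... | inj₁ (vi≡p , vi⁺≡q) | inj₂ (vj≡q , vj⁺≡p) =
      reversed (v-inj (trans vi≡p (sym vj⁺≡p))) (v-inj (trans vi⁺≡q (sym vj≡q)))
    ... | inj₂ (vi≡q , vi⁺≡p) | inj₁ (vj≡p , vj⁺≡q) =
      reversed (v-inj (trans vi≡q (sym vj⁺≡q))) (v-inj (trans vi⁺≡p (sym vj≡p)))

    ascent : Fin (suc m) → Bool
    ascent i = does (v i F.<? v (nextC i))

    descent : Fin (suc m) → Bool
    descent i = does (v (nextC i) F.<? v i)

    ascent-< : ∀ {i} → v i < v (nextC i) → ascent i ≡ true
    ascent-< {i} = dec-true (v i F.<? v (nextC i))

    ascent-> : ∀ {i} → v (nextC i) < v i → ascent i ≡ false
    ascent-> {i} vi⁺<vi = dec-false (v i F.<? v (nextC i)) (ℕP.<⇒≯ vi⁺<vi)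

    descent≡not-ascent : ∀ i → descent i ≡ not (ascent i)
    descent≡not-ascent i with ℕP.<-cmp (toℕ (v i)) (toℕ (v (nextC i)))
    ... | tri< vi<vi⁺ _ _ = trans (dec-false (v (nextC i) F.<? v i) (ℕP.<⇒≯ vi<vi⁺)) (cong not (sym (ascent-< vi<vi⁺)))
    ... | tri> _ _ vi⁺<vi = trans (dec-true (v (nextC i) F.<? v i) vi⁺<vi) (cong not (sym (ascent-> vi⁺<vi)))
    ... | tri≈ _ vi≡vi⁺ _ =
      contradiction (v-inj (FP.toℕ-injective vi≡vi⁺)) (nextC≢id i (ℕP.≤-trans (s≤s z≤n) 2≤m) ∘ sym)

    orientation : Fin (suc m) → ℤ
    orientation i = if ascent i then 1ℤ else -1ℤ

    orientation-unit : ∀ i → IsUnit (orientation i)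
    orientation-unit i with ascent i
    ... | true  = inj₁ refl
    ... | false = inj₂ refl

    orientation-coeff : ∀ i c →
                        orientation i * coeffMatrix (κ i) c ≡ step (toℕ (v i)) (toℕ c) - step (toℕ (v (nextC i))) (toℕ c)
    orientation-coeff i c with κ-joins i
    ... | inj₁ eq = begin
      orientation i * coeff (S (κ i)) c
        ≡⟨ cong₂ _*_ (cong (if_then 1ℤ else -1ℤ) (ascent-< vi<vi⁺)) (cong (λ e → coeff e c) eq) ⟩
      1ℤ * coeff (v i , v (nextC i)) c
        ≡⟨ ℤP.*-identityˡ _ ⟩
      coeff (v i , v (nextC i)) c
        ≡⟨ coeff≡interval (v i) (v (nextC i)) c vi<vi⁺ ⟩
      step (toℕ (v i)) (toℕ c) - step (toℕ (v (nextC i))) (toℕ c) ∎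
      where
      open ≡-Reasoning
      vi<vi⁺ : v i < v (nextC i)
      vi<vi⁺ = ordered-≡ eq
    ... | inj₂ eq = begin
      orientation i * coeff (S (κ i)) c
        ≡⟨ cong₂ _*_ (cong (if_then 1ℤ else -1ℤ) (ascent-> vi⁺<vi)) (cong (λ e → coeff e c) eq) ⟩
      -1ℤ * coeff (v (nextC i) , v i) c
        ≡⟨ cong (-1ℤ *_) (coeff≡interval (v (nextC i)) (v i) c vi⁺<vi) ⟩
      -1ℤ * (step (toℕ (v (nextC i))) (toℕ c) - step (toℕ (v i)) (toℕ c))
        ≡⟨ flip (step (toℕ (v (nextC i))) (toℕ c)) (step (toℕ (v i)) (toℕ c)) ⟩
      step (toℕ (v i)) (toℕ c) - step (toℕ (v (nextC i))) (toℕ c) ∎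
      where
      open ≡-Reasoning
      vi⁺<vi : v (nextC i) < v i
      vi⁺<vi = ordered-≡ eq
      flip : ∀ s t → -1ℤ * (s - t) ≡ t - s
      flip = solve-∀

    cycleVector : Fin (suc n) → ℤ
    cycleVector k = sum (λ i → if does (κ i F.≟ k) then orientation i else 0ℤ)

    cycleVector-κ : ∀ i → cycleVector (κ i) ≡ orientation i
    cycleVector-κ i =
      trans (sum-single i _ (λ j j≢i → cong (if_then orientation j else 0ℤ) (dec-false (κ j F.≟ κ i) (j≢i ∘ κ-injective))))
            (cong (if_then orientation i else 0ℤ) (dec-true (κ i F.≟ κ i) refl))

    cycleVector-off : ∀ k → (∀ i → κ i ≢ k) → cycleVector k ≡ 0ℤ
    cycleVector-off k k∉κ = sum-zero _ (λ i → cong (if_then orientation i else 0ℤ) (dec-false (κ i F.≟ k) (k∉κ i)))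

    cycleVector-leftKernel : LeftKernel coeffMatrix cycleVector
    cycleVector-leftKernel c = begin
      sum (λ k → cycleVector k * coeffMatrix k c)
        ≡⟨ sum-injective-reindex κ _ κ-injective off-cycle ⟩
      sum (λ i → cycleVector (κ i) * coeffMatrix (κ i) c)
        ≡⟨ sum-cong-≗ (λ i → trans (cong (_* coeffMatrix (κ i) c) (cycleVector-κ i)) (orientation-coeff i c)) ⟩
      sum (λ i → G (v i) - G (v (nextC i)))
        ≡⟨ ∑-distrib-minus (G ∘ v) (G ∘ v ∘ nextC) ⟩
      sum (G ∘ v) - sum (G ∘ v ∘ nextC)
        ≡⟨ cong (_-_ (sum (G ∘ v))) (sum-nextC (G ∘ v)) ⟨
      sum (G ∘ v) - sum (G ∘ v)
        ≡⟨ ℤP.+-inverseʳ (sum (G ∘ v)) ⟩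
      0ℤ ∎
      where
      open ≡-Reasoning
      G : Fin (suc n) → ℤ
      G x = step (toℕ x) (toℕ c)
      off-cycle : ∀ k → (∀ i → κ i ≢ k) → cycleVector k * coeffMatrix k c ≡ 0ℤ
      off-cycle k k∉κ = trans (cong (_* coeffMatrix k c) (cycleVector-off k k∉κ)) (ℤP.*-zeroˡ (coeffMatrix k c))

    Proportional : ℤ → Set
    Proportional μ = ∀ k → dCoef S k ≡ μ * cycleVector k

    -- μ is chosen so that the left-kernel vector d − μ z vanishes on the first edge of the cycle.
    dCoef-proportional : ForestWithout (κ zero) → Proportional (dCoef S (κ zero) * orientation zero)
    dCoef-proportional forest k = ℤP.i-j≡0⇒i≡j _ _
      (leftKernel-vanishing (κ zero) forest (λ k → dCoef S k - μ * cycleVector k)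
        (LeftKernel-combination {B = coeffMatrix} {dCoef S} {cycleVector} μ dCoef-leftKernel cycleVector-leftKernel)
        vanishes k)
      where
      d₀ μ : ℤ
      d₀ = dCoef S (κ zero)
      μ  = d₀ * orientation zero
      vanishes : d₀ - μ * cycleVector (κ zero) ≡ 0ℤ
      vanishes = begin
        d₀ - μ * cycleVector (κ zero)
          ≡⟨ cong (λ z → d₀ - μ * z) (cycleVector-κ zero) ⟩
        d₀ - (d₀ * orientation zero) * orientation zero
          ≡⟨ reassoc d₀ (orientation zero) ⟩
        d₀ - d₀ * (orientation zero * orientation zero)
          ≡⟨ cong (λ s → d₀ - d₀ * s) (IsUnit-sq (orientation-unit zero)) ⟩
        d₀ - d₀ * 1ℤ
          ≡⟨ cancel d₀ ⟩
        0ℤ ∎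
        where
        open ≡-Reasoning
        reassoc : ∀ a s → a - (a * s) * s ≡ a - a * (s * s)
        reassoc = solve-∀
        cancel : ∀ a → a - a * 1ℤ ≡ 0ℤ
        cancel = solve-∀

    edge-on-cycle : ∀ i → CycEdge v (proj₁ (S (κ i))) (proj₂ (S (κ i)))
    edge-on-cycle i = i , Equivalence.to Joins⇔endpoints (κ-joins i)

    IsUniqueCycle : Set
    IsUniqueCycle = ∀ m′ (w : Fin (suc m′) → Fin (suc n)) → IsCycle S w → ∀ a b → CycEdge w a b ⇔ CycEdge v a b

    -- A nonempty leafless H contains a cycle, whose edges are those of v, including κ i.
    uniqueCycle⇒forestWithout : IsUniqueCycle → ∀ i → ForestWithout (κ i)
    uniqueCycle⇒forestWithout unique i H κi∉H leafless k with H k in k∈H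
    ... | false = refl
    ... | true  = contradiction (trans (sym κi∉H) (Cycle-edge∈H c (κ i) c∋κi)) λ ()
      where
      c : Cycle (AdjIn S H)
      c = leafless-cycle H leafless k k∈H
      c∋κi : CycEdge (Cycle.vertex c) (proj₁ (S (κ i))) (proj₂ (S (κ i)))
      c∋κi = Equivalence.from (unique _ _ (Cycle⇒IsCycle c) _ _) (edge-on-cycle i)

    count-multiple : ∀ μ t → t ≢ 0ℤ → Proportional μ →
                     countFin (λ k → isℤ (dCoef S k) t) ≡ countFin (λ i → isℤ (μ * orientation i) t)
    count-multiple μ t t≢0 d≡μz = begin
      countFin (λ k → isℤ (dCoef S k) t)
        ≡⟨ count-cong (λ k → cong (λ x → isℤ x t) (d≡μz k)) ⟩
      countFin (λ k → isℤ (μ * cycleVector k) t)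
        ≡⟨ count-injective-reindex κ _ κ-injective onCycle ⟩
      countFin (λ i → isℤ (μ * cycleVector (κ i)) t)
        ≡⟨ count-cong (λ i → cong (λ x → isℤ (μ * x) t) (cycleVector-κ i)) ⟩
      countFin (λ i → isℤ (μ * orientation i) t) ∎
      where
      open ≡-Reasoning
      onCycle : ∀ k → isℤ (μ * cycleVector k) t ≡ true → ∃ λ i → κ i ≡ k
      onCycle k μz≡t with FP.any? (λ i → κ i F.≟ k)
      ... | yes found = found
      ... | no  ∄i    = contradiction (trans (sym (isℤ⇒≡ μz≡t)) μz≡0) t≢0
        where
        μz≡0 : μ * cycleVector k ≡ 0ℤ
        μz≡0 = trans (cong (μ *_) (cycleVector-off k (λ i eq → ∄i (i , eq)))) (ℤP.*-zeroʳ μ)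

    isℤ-ascent : ∀ {μ} → IsUnit μ → ∀ i → isℤ (μ * orientation i) μ ≡ ascent i
    isℤ-ascent (inj₁ refl) i with ascent i
    ... | true  = refl
    ... | false = refl
    isℤ-ascent (inj₂ refl) i with ascent i
    ... | true  = refl
    ... | false = refl

    isℤ-descent : ∀ {μ} → IsUnit μ → ∀ i → isℤ (μ * orientation i) (- μ) ≡ descent i
    isℤ-descent μ-unit i = trans (flipped μ-unit) (sym (descent≡not-ascent i))
      where
      flipped : ∀ {μ} → IsUnit μ → isℤ (μ * orientation i) (- μ) ≡ not (ascent i)
      flipped (inj₁ refl) with ascent i
      ... | true  = refl
      ... | false = refl
      flipped (inj₂ refl) with ascent i
      ... | true  = refl
      ... | false = refl

    count-ascents : ∀ {μ} → IsUnit μ → Proportional μ → countFin (λ k → isℤ (dCoef S k) μ) ≡ casc v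
    count-ascents {μ} μ-unit d≡μz =
      trans (count-multiple μ μ (IsUnit≢0 μ-unit) d≡μz) (count-cong (isℤ-ascent μ-unit))

    count-descents : ∀ {μ} → IsUnit μ → Proportional μ → countFin (λ k → isℤ (dCoef S k) (- μ)) ≡ cdsc v
    count-descents {μ} μ-unit d≡μz =
      trans (count-multiple μ (- μ) (IsUnit≢0 (IsUnit-neg μ-unit)) d≡μz) (count-cong (isℤ-descent μ-unit))

    signature : ∀ {μ} → IsUnit μ → Proportional μ → PairEq (sigA S) (sigB S) (casc v) (cdsc v)
    signature (inj₁ refl) d≡μz = inj₁ (count-ascents (inj₁ refl) d≡μz , count-descents (inj₁ refl) d≡μz)
    signature (inj₂ refl) d≡μz = inj₂ (count-descents (inj₂ refl) d≡μz , count-ascents (inj₂ refl) d≡μz)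

lemma2p5 : (n : ℕ) → 1 ≤ n →
    (S : Fin (suc n) → Edge (suc n)) →
    (∀ k → proj₁ (S k) < proj₂ (S k)) →
    Injective _≡_ _≡_ S →
    (m : ℕ) → (v : Fin (suc m) → Fin (suc n)) →
    IsCycle S v →
    (∀ (m′ : ℕ) (w : Fin (suc m′) → Fin (suc n)) → IsCycle S w →
      ∀ a b → CycEdge w a b ⇔ CycEdge v a b) →
    PairEq (sigA S) (sigB S) (casc v) (cdsc v)
lemma2p5 n _ S ordered S-inj m v cycle unique =
  signature (IsUnit-* (dCoef-unit (κ zero) forest) (orientation-unit zero)) (dCoef-proportional forest)
  where
  open EdgeList S ordered S-inj
  open CycleVector v cycle
  forest : ForestWithout (κ zero)
  forest = uniqueCycle⇒forestWithout unique zero
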